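{- Under the standing assumptions below, one of the following holds: (1) $T$ acts semiregularly on the set of blocks of $\mathcal D$, and $k$ divides $r$; (2) $T$ does not act semiregularly on the set of blocks, and one of the following holds: (a) $k=p^{t}$ with $t>1$, and the blocks of $\mathcal{D}$ are (affine) subspaces of $AG_{d}(p)$, i.e. cosets of $GF(p)$-subspaces of $V$; (b) $k=2p^{t}$ with $p$ odd and $t\geq 1$.
   Context: Standing assumptions: $\mathcal{D}=(\mathcal P,\mathcal B)$ is a non-trivial $2$-$(v,k,2)$ design (any two distinct points lie in exactly $2$ blocks, blocks have size $k$, $2<k<v$), with replication number $r$ (number of blocks through a point). $G\le \mathrm{Aut}(\mathcal D)$ is flag-transitive (transitive on incident point–block pairs) and point-primitive, and the socle $T$ of $G$ is an elementary abelian $p$-group ($p$ prime) acting regularly on points. Thus $\mathcal P$ is identified with $V=V_d(p)=GF(p)^d$, $T$ is the translation group of $V$, $v=p^d$, and $G=T:G_0\le AGL_d(p)$, where $G_0$ is the stabilizer of the zero vector and acts irreducibly on $V$. Moreover $r$ is assumed to be even. -}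

module Defs where

open import Data.Nat as ℕ using (ℕ; zero; suc; NonZero; _∸_)
open import Data.Nat.DivMod using (_mod_)
open import Data.Fin as Fin using (Fin; toℕ)
open import Data.Bool using (Bool; true; false; if_then_else_; _∧_)
open import Data.List as List using (List; []; _∷_; length; filterᵇ; concatMap; allFin)
open import Data.Vec as Vec using (Vec; []; _∷_; zipWith; foldr; tabulate; transpose; replicate)
open import Data.Product using (Σ; _×_; _,_; ∃)
open import Relation.Nullary using (does)
open import Relation.Binary.PropositionalEquality using (_≡_)

countᵇ : ∀ {a} {A : Set a} → (A → Bool) → List A → ℕ
countᵇ f xs = length (filterᵇ f xs)

-- Affine geometry over GF(p) (p prime, elements of GF(p) are Fin p with
-- arithmetic mod p), V = GF(p)^d as Vec (Fin p) d.
module Affine (p : ℕ) .{{nz : NonZero p}} (d : ℕ) where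

  F : Set
  F = Fin p

  0F 1F : F
  0F = 0 mod p
  1F = 1 mod p

  _⊕_ _⊗_ : F → F → F
  a ⊕ b = (toℕ a ℕ.+ toℕ b) mod p
  a ⊗ b = (toℕ a ℕ.* toℕ b) mod p

  ⊖_ : F → F
  ⊖ a = (p ∸ toℕ a) mod p

  V : Set
  V = Vec F d

  0ᵥ : V
  0ᵥ = replicate d 0F

  _+ᵥ_ _-ᵥ_ : V → V → V
  x +ᵥ y = zipWith _⊕_ x y
  x -ᵥ y = zipWith (λ a b → a ⊕ (⊖ b)) x y

  _·ᵥ_ : F → V → V
  a ·ᵥ x = Vec.map (a ⊗_) x

  allVec : ∀ n → List (Vec F n)
  allVec zero    = [] ∷ []
  allVec (suc n) = concatMap (λ a → List.map (a ∷_) (allVec n)) (allFin p)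

  allV : List V
  allV = allVec d

  Mat : Set
  Mat = Vec (Vec F d) d

  dot : ∀ {n} → Vec F n → Vec F n → F
  dot u w = foldr (λ _ → F) _⊕_ 0F (zipWith _⊗_ u w)

  applyM : Mat → V → V
  applyM A x = Vec.map (λ row → dot row x) A

  _∘M_ : Mat → Mat → Mat
  A ∘M B = Vec.map (λ row → applyM (transpose B) row) A

  idM : Mat
  idM = tabulate (λ i → tabulate (λ j → if does (i Fin.≟ j) then 1F else 0F))

  Invertible : Mat → Set
  Invertible A = Σ Mat (λ B → (B ∘M A) ≡ idM)

  -- elements of AGL_d(p) (with invertible linear part) represented as
  -- pairs (A , c) acting by x ↦ A x + c
  Aff : Set
  Aff = Mat × V

  ⟦_⟧ : Aff → V → V
  ⟦ A , c ⟧ x = applyM A x +ᵥ c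

  -- composition: ⟦ g ∘A h ⟧ = ⟦ g ⟧ ∘ ⟦ h ⟧
  _∘A_ : Aff → Aff → Aff
  (A , c) ∘A (B , e) = (A ∘M B) , (applyM A e +ᵥ c)

  translation : V → Aff
  translation c = idM , c

  -- G ≤ AGL_d(p), given as a predicate on Aff: contains the identity,
  -- closed under composition, linear parts invertible (G is finite, so
  -- this makes G a subgroup).
  IsSubgroupAGL : (Aff → Set) → Set
  IsSubgroupAGL G =
    G (idM , 0ᵥ)
    × (∀ g h → G g → G h → G (g ∘A h))
    × (∀ A c → G (A , c) → Invertible A)

  ContainsTranslations : (Aff → Set) → Set
  ContainsTranslations G = ∀ c → G (translation c)

  IsSubspace : (V → Bool) → Set
  IsSubspace W =
    W 0ᵥ ≡ true
    × (∀ x y → W x ≡ true → W y ≡ true → W (x +ᵥ y) ≡ true)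
    × (∀ a x → W x ≡ true → W (a ·ᵥ x) ≡ true)

  -- G₀ = stabiliser of 0 in G = elements (A , 0) of G; G₀ acts
  -- irreducibly on V
  G₀Irreducible : (Aff → Set) → Set
  G₀Irreducible G =
    ∀ (W : V → Bool) → IsSubspace W
    → (∀ A → G (A , 0ᵥ) → ∀ x → W x ≡ true → W (applyM A x) ≡ true)
    → (∀ x → W x ≡ true → x ≡ 0ᵥ) ⊎' (∀ x → W x ≡ true)
    where
    open import Data.Sum renaming (_⊎_ to _⊎'_)

  -- Designs with point set V: b blocks B i (i : Fin b), each a subset
  -- of V given by its membership function.

  -- the blocks are pairwise distinct (the block set is a set)
  DistinctBlocks : ∀ {b} → (Fin b → V → Bool) → Set
  DistinctBlocks B = ∀ i j → (∀ x → B i x ≡ B j x) → i ≡ j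

  BlockSize : ∀ {b} → (Fin b → V → Bool) → ℕ → Set
  BlockSize B k = ∀ i → countᵇ (B i) allV ≡ k

  Balanced : ∀ {b} → (Fin b → V → Bool) → ℕ → Set
  Balanced {b} B λ' = ∀ x y → ¬' (x ≡ y)
    → countᵇ (λ i → B i x ∧ B i y) (allFin b) ≡ λ'
    where
    open import Relation.Nullary renaming (¬_ to ¬'_)

  Replication : ∀ {b} → (Fin b → V → Bool) → ℕ → Set
  Replication {b} B r = ∀ x → countᵇ (λ i → B i x) (allFin b) ≡ r

  MapsBlock : ∀ {b} → (Fin b → V → Bool) → Aff → Fin b → Fin b → Set
  MapsBlock B g i j = ∀ x → B j (⟦ g ⟧ x) ≡ B i x

  Automorphisms : ∀ {b} → (Fin b → V → Bool) → (Aff → Set) → Set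
  Automorphisms B G = ∀ g → G g → ∀ i → ∃ (λ j → MapsBlock B g i j)

  FlagTransitive : ∀ {b} → (Fin b → V → Bool) → (Aff → Set) → Set
  FlagTransitive B G =
    ∀ x i y j → B i x ≡ true → B j y ≡ true
    → Σ Aff (λ g → G g × ⟦ g ⟧ x ≡ y × MapsBlock B g i j)

  TSemiregularOnBlocks : ∀ {b} → (Fin b → V → Bool) → Set
  TSemiregularOnBlocks B = ∀ c i → MapsBlock B (translation c) i i → c ≡ 0ᵥ

  BlocksAreAffineSubspaces : ∀ {b} → (Fin b → V → Bool) → Set
  BlocksAreAffineSubspaces B =
    ∀ i → Σ V (λ a → Σ (V → Bool) (λ W → IsSubspace W × (∀ x → B i x ≡ W (x -ᵥ a))))

{-# OPTIONS --safe #-}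
module Submission where

-- The translation group T ≅ V acts on the blocks.  If the action is semiregular,
-- every T-orbit of blocks has p^d elements, so p^d ∣ b, and bk = vr gives k ∣ r.
-- Otherwise some block has a nonzero stabiliser, and since G is flag-transitive and
-- normalises T, every block B does.  The stabiliser T_B is a subgroup of V, so
-- |T_B| = p^t by Lagrange.  For a ∈ B and 0 ≠ c ∈ T_B, each translate B + (a - y)
-- with y ∈ B contains the pair {a, a + c}, which lies in only λ = 2 blocks; hence B
-- is one or two cosets of T_B, and k = p^t or k = 2p^t.  In the one-coset case k = p
-- is impossible: the other block through {a, a + c} would be a coset of an order-p
-- subgroup containing c, i.e. of T_B, and so would equal B.  Subgroups of V are
-- GF(p)-subspaces, and in characteristic 2 a union of two cosets a + T_B and
-- a + w + T_B is a coset of the subgroup T_B ∪ (w + T_B).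

open import Defs

import Data.Bool as Bool
open import Data.Bool using (Bool; true; false; _∧_; _∨_; not; T?; if_then_else_)
open import Data.Bool.Properties using (T-≡; ∨-zeroʳ; ∧-conicalˡ; ∧-conicalʳ; ∧-identityʳ; not-¬; ⇔→≡)
open import Data.Empty using (⊥; ⊥-elim)
open import Data.Fin as Fin using (Fin; toℕ)
open import Data.Fin.Properties using (toℕ-fromℕ<; toℕ-injective; toℕ<n)
open import Data.List as List
  using (List; []; _∷_; _++_; length; filter; filterᵇ; map; concatMap; cartesianProductWith; allFin)
open import Data.List.Membership.Propositional using (_∈_; _∉_; lose)
open import Data.List.Membership.Propositional.Properties
  using (∈-filter⁺; ∈-filter⁻; ∈-map⁺; ∈-map⁻; ∈-cartesianProductWith⁺; ∈-allFin)
open import Data.List.Properties using (filter-notAll; filter-all; length-map; length-++; length-tabulate)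
open import Data.List.Relation.Binary.Subset.Propositional using (_⊆_)
open import Data.List.Relation.Unary.All as All using (All; []; _∷_)
open import Data.List.Relation.Unary.AllPairs using ([]; _∷_)
open import Data.List.Relation.Unary.Any as Any using (Any; here; there)
open import Data.List.Relation.Unary.Unique.Propositional using (Unique)
open import Data.List.Relation.Unary.Unique.Propositional.Properties as Unique using (Unique[x∷xs]⇒x∉xs; allFin⁺)
open import Data.Nat
  using (ℕ; zero; suc; _+_; _*_; _^_; _∸_; _%_; _≤_; _<_; z≤n; s≤s; z<s; s<s; s≤s⁻¹; NonZero;
         nonTrivial⇒n>1; >-nonZero⁻¹)
open import Data.Nat.Coprimality using (Coprime; coprime-divisor)
open import Data.Nat.Divisibility using (_∣_; divides; _∣?_; _∣0; ∣1⇒≡1; *-cancelʳ-∣; ∣m∣n⇒∣m+n; ∣-refl)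
open import Data.Nat.DivMod using (_mod_; %-distribˡ-+; %-distribˡ-*; m<n⇒m%n≡m; n%n≡0; m*n%n≡0)
open import Data.Nat.ListAction using (sum)
open import Data.Nat.Primality using (Prime; prime⇒nonZero; prime⇒irreducible; prime⇒nonTrivial; euclidsLemma; prime[2])
open import Data.Nat.Properties
  using (+-comm; +-assoc; +-identityʳ; +-suc; *-comm; *-assoc; *-identityˡ; *-identityʳ; *-zeroʳ;
         *-distribˡ-+; *-cancelˡ-≡; m+[n∸m]≡n; m^n≢0; +-commutativeSemigroup; ≤-refl; ≤-reflexive; ≤-trans;
         ≤-antisym; <-trans; <-≤-trans; ≤-<-trans; <-irrefl; <⇒≤; >⇒≢; ≮⇒≥; n≤0⇒n≡0; +-monoˡ-≤; _<?_)
open import Algebra.Properties.CommutativeSemigroup +-commutativeSemigroup using (x∙yz≈y∙xz)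
open import Data.Product using (Σ; _×_; _,_; proj₁; proj₂; ∃)
open import Data.Sum using (_⊎_; inj₁; inj₂; [_,_])
open import Data.Vec as Vec using (Vec; []; _∷_; zipWith; replicate; tabulate; transpose; _⊛_)
open import Data.Vec.Properties
  using (∷-injective; ≡-dec; zipWith-assoc; zipWith-comm; zipWith-identityʳ; map-replicate; map-cong; map-const;
         map-∘; tabulate-∘; tabulate-cong; tabulate∘lookup)
open import Function using (id; _∘_; Equivalence; mk⇔)
open import Relation.Binary.Definitions using (DecidableEquality)
open import Relation.Binary.PropositionalEquality
  using (_≡_; _≢_; refl; sym; trans; cong; cong₂; subst; subst₂; module ≡-Reasoning)
open import Relation.Nullary using (¬_; Dec; yes; no; does; ¬?; _×-dec_; contradiction; map′)
open import Relation.Nullary.Decidable using (dec-true; decidable-stable)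
open import Relation.Unary using (Pred; Decidable)

does⇒ : ∀ {ℓ} {A : Set ℓ} (a? : Dec A) → does a? ≡ true → A
does⇒ (yes a) _ = a

Bool-ext : ∀ {x y : Bool} → (x ≡ true → y ≡ true) → (y ≡ true → x ≡ true) → x ≡ y
Bool-ext x⇒y y⇒x = ⇔→≡ (mk⇔ x⇒y y⇒x)

subst-true : ∀ {A : Set} (P : A → Bool) {x y} → x ≡ y → P x ≡ true → P y ≡ true
subst-true P = subst (λ z → P z ≡ true)

∨-true⁻ : ∀ {x y : Bool} → (x ∨ y) ≡ true → x ≡ true ⊎ y ≡ true
∨-true⁻ {true}  _ = inj₁ refl
∨-true⁻ {false} y = inj₂ y

module _ {A : Set} (_≟_ : DecidableEquality A) where

  open import Data.List.Membership.DecPropositional _≟_ using (_∈?_)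

  without : A → List A → List A
  without y = filter (λ x → ¬? (x ≟ y))

  length-without< : ∀ {y ys} → y ∈ ys → length (without y ys) < length ys
  length-without< {ys = ys} y∈ys =
    filter-notAll (λ x → ¬? (x ≟ _)) ys (Any.map (λ y≡x x≢y → x≢y (sym y≡x)) y∈ys)

  ⊆-without : ∀ {y xs ys} → y ∉ xs → xs ⊆ ys → xs ⊆ without y ys
  ⊆-without y∉xs xs⊆ys x∈xs =
    ∈-filter⁺ (λ x → ¬? (x ≟ _)) (xs⊆ys x∈xs) (λ x≡y → y∉xs (subst (_∈ _) x≡y x∈xs))

  unique-⊆⇒length≤ : ∀ {xs ys} → Unique xs → xs ⊆ ys → length xs ≤ length ys
  unique-⊆⇒length≤ {[]} _ _ = z≤n
  unique-⊆⇒length≤ {x ∷ xs} x∷xs!@(_ ∷ xs!) x∷xs⊆ys =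
    ≤-trans (s≤s (unique-⊆⇒length≤ xs! (⊆-without (Unique[x∷xs]⇒x∉xs x∷xs!) (x∷xs⊆ys ∘ there))))
            (length-without< (x∷xs⊆ys (here refl)))

  unique-⊆-length≥⇒⊇ : ∀ {xs ys} → Unique xs → xs ⊆ ys → length ys ≤ length xs → ys ⊆ xs
  unique-⊆-length≥⇒⊇ {xs} xs! xs⊆ys ys≤xs {y} y∈ys with y ∈? xs
  ... | yes y∈xs = y∈xs
  ... | no y∉xs = contradiction
    (<-≤-trans (≤-<-trans (unique-⊆⇒length≤ xs! (⊆-without y∉xs xs⊆ys)) (length-without< y∈ys)) ys≤xs)
    (<-irrefl refl)

module _ {A : Set} (P : A → Bool) {x : A} where

  ∈-filterᵇ⁺ : ∀ {xs} → x ∈ xs → P x ≡ true → x ∈ filterᵇ P xs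
  ∈-filterᵇ⁺ x∈xs Px = ∈-filter⁺ (T? ∘ P) x∈xs (Equivalence.from T-≡ Px)

  ∈-filterᵇ⁻ : ∀ xs → x ∈ filterᵇ P xs → x ∈ xs × P x ≡ true
  ∈-filterᵇ⁻ xs x∈ = let x∈xs , Px = ∈-filter⁻ (T? ∘ P) {xs = xs} x∈ in x∈xs , Equivalence.to T-≡ Px

module _ {A : Set} where

  countᵇ-cong : ∀ {P P' : A → Bool} → (∀ x → P x ≡ P' x) → ∀ xs → countᵇ P xs ≡ countᵇ P' xs
  countᵇ-cong _ [] = refl
  countᵇ-cong {P} {P'} P≗P' (x ∷ xs) with P x | P' x | P≗P' x
  ... | true  | .true  | refl = cong suc (countᵇ-cong P≗P' xs)
  ... | false | .false | refl = countᵇ-cong P≗P' xs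

  countᵇ-∨ : ∀ {P P' : A → Bool} → (∀ x → P x ≡ true → P' x ≡ true → ⊥) →
             ∀ xs → countᵇ (λ x → P x ∨ P' x) xs ≡ countᵇ P xs + countᵇ P' xs
  countᵇ-∨ _ [] = refl
  countᵇ-∨ {P} {P'} disjoint (x ∷ xs) with P x in Px | P' x in P'x
  ... | true  | true  = ⊥-elim (disjoint x Px P'x)
  ... | true  | false = cong suc (countᵇ-∨ disjoint xs)
  ... | false | true  = trans (cong suc (countᵇ-∨ disjoint xs)) (sym (+-suc _ _))
  ... | false | false = countᵇ-∨ disjoint xs

length-cartesianProductWith : ∀ {A B C : Set} (f : A → B → C) xs ys →
                              length (cartesianProductWith f xs ys) ≡ length xs * length ys
length-cartesianProductWith f []       ys = refl
length-cartesianProductWith f (x ∷ xs) ys =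
  trans (length-++ (map (f x) ys)) (cong₂ _+_ (length-map (f x) ys) (length-cartesianProductWith f xs ys))

sum-map-const : ∀ {A : Set} {f : A → ℕ} {c} → (∀ x → f x ≡ c) → ∀ xs →
                sum (map f xs) ≡ length xs * c
sum-map-const f≡c []       = refl
sum-map-const f≡c (x ∷ xs) = cong₂ _+_ (f≡c x) (sum-map-const f≡c xs)

module _ {X Y : Set} (R : X → Y → Bool) where

  private
    shift-summand : ∀ a b c {s} → s ≡ b + c → a + s ≡ b + (a + c)
    shift-summand a b c s≡b+c = trans (cong (a +_) s≡b+c) (x∙yz≈y∙xz a b c)

    column-sum : List X → List Y → ℕ
    column-sum xs ys = sum (map (λ y → countᵇ (λ x → R x y) xs) ys)

    column-sum-∷ : ∀ x xs ys → column-sum (x ∷ xs) ys ≡ countᵇ (R x) ys + column-sum xs ys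
    column-sum-∷ x xs []       = refl
    column-sum-∷ x xs (y ∷ ys) with R x y
    ... | true  = cong suc (shift-summand _ (countᵇ (R x) ys) (column-sum xs ys) (column-sum-∷ x xs ys))
    ... | false = shift-summand _ (countᵇ (R x) ys) (column-sum xs ys) (column-sum-∷ x xs ys)

    row-sum≡column-sum : ∀ xs ys → sum (map (λ x → countᵇ (R x) ys) xs) ≡ column-sum xs ys
    row-sum≡column-sum []       ys = sym (trans (sum-map-const (λ _ → refl) ys) (*-zeroʳ (length ys)))
    row-sum≡column-sum (x ∷ xs) ys =
      trans (cong (countᵇ (R x) ys +_) (row-sum≡column-sum xs ys)) (sym (column-sum-∷ x xs ys))

  double-counting : ∀ {xs ys m n} → (∀ x → countᵇ (R x) ys ≡ m) → (∀ y → countᵇ (λ x → R x y) xs ≡ n) →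
                    length xs * m ≡ length ys * n
  double-counting {xs} {ys} rows columns =
    trans (sym (sum-map-const rows xs)) (trans (row-sum≡column-sum xs ys) (sum-map-const columns ys))

record Enumeration (A : Set) : Set where
  field
    _≟_      : DecidableEquality A
    elements : List A
    unique   : Unique elements
    complete : ∀ x → x ∈ elements

Finᴱ : ∀ n → Enumeration (Fin n)
Finᴱ n = record { _≟_ = Fin._≟_ ; elements = allFin n ; unique = allFin⁺ n ; complete = ∈-allFin }

module _ {A : Set} (E : Enumeration A) where
  open Enumeration E

  count : (A → Bool) → ℕ
  count P = countᵇ P elements

  ∃? : ∀ {ℓ} {P : Pred A ℓ} → Decidable P → Dec (∃ P)
  ∃? P? = map′ Any.satisfied (λ (x , Px) → lose (complete x) Px) (Any.any? P? elements)

  count-cong : ∀ {P P'} → (∀ x → P x ≡ P' x) → count P ≡ count P'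
  count-cong P≗P' = countᵇ-cong P≗P' elements

  count-∨ : ∀ {P P'} → (∀ x → P x ≡ true → P' x ≡ true → ⊥) →
            count (λ x → P x ∨ P' x) ≡ count P + count P'
  count-∨ disjoint = countᵇ-∨ disjoint elements

  count-all : count (λ _ → true) ≡ length elements
  count-all = cong length (filter-all (T? ∘ λ _ → true) (All.universal _ elements))

  count-witness : ∀ {P} → 0 < count P → ∃ λ x → P x ≡ true
  count-witness {P} 0<count with filterᵇ P elements in eq
  ... | x ∷ _ = x , proj₂ (∈-filterᵇ⁻ P elements (subst (x ∈_) (sym eq) (here refl)))

  length≤count : ∀ {P zs} → Unique zs → (∀ {z} → z ∈ zs → P z ≡ true) → length zs ≤ count P
  length≤count {P} zs! Pzs =
    unique-⊆⇒length≤ _≟_ zs! (λ z∈zs → ∈-filterᵇ⁺ P (complete _) (Pzs z∈zs))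

  count≤length : ∀ {P zs} → (∀ {x} → P x ≡ true → x ∈ zs) → count P ≤ length zs
  count≤length {P} P⊆zs =
    unique-⊆⇒length≤ _≟_ (Unique.filter⁺ (T? ∘ P) unique) (λ x∈ → P⊆zs (proj₂ (∈-filterᵇ⁻ P elements x∈)))

module _ {A A' : Set} (E : Enumeration A) (E' : Enumeration A') {P : A → Bool} {P' : A' → Bool} {h : A → A'}
         (h-injective : ∀ {x y} → h x ≡ h y → x ≡ y) (h-maps : ∀ {x} → P x ≡ true → P' (h x) ≡ true) where
  open Enumeration

  private
    image : List A'
    image = map h (filterᵇ P (elements E))

    length-image : length image ≡ count E P
    length-image = length-map h (filterᵇ P (elements E))

    image-unique : Unique image
    image-unique = Unique.map⁺ h-injective (Unique.filter⁺ (T? ∘ P) (unique E))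

    image⊆ : image ⊆ filterᵇ P' (elements E')
    image⊆ y∈ with ∈-map⁻ h y∈
    ... | x , x∈ , refl =
      ∈-filterᵇ⁺ P' (complete E' (h x)) (h-maps (proj₂ (∈-filterᵇ⁻ P (elements E) x∈)))

  count-≤-injection : count E P ≤ count E' P'
  count-≤-injection = subst (_≤ count E' P') length-image (unique-⊆⇒length≤ (_≟_ E') image-unique image⊆)

  injection-onto : count E' P' ≤ count E P → ∀ {y} → P' y ≡ true → ∃ λ x → P x ≡ true × h x ≡ y
  injection-onto P'≤P {y} P'y
    with ∈-map⁻ h (unique-⊆-length≥⇒⊇ (_≟_ E') image-unique image⊆
                     (subst (count E' P' ≤_) (sym length-image) P'≤P) (∈-filterᵇ⁺ P' (complete E' y) P'y))
  ... | x , x∈ , refl = x , proj₂ (∈-filterᵇ⁻ P (elements E) x∈) , refl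

module _ {p : ℕ} (p-prime : Prime p) where

  ∣p^⇒≡p^ : ∀ n {m} → m ∣ p ^ n → ∃ λ t → m ≡ p ^ t
  ∣p^⇒≡p^ zero m∣1 = 0 , ∣1⇒≡1 m∣1
  ∣p^⇒≡p^ (suc n) {m} m∣p^1+n with p ∣? m
  ... | yes (divides q refl) =
    let instance _ = prime⇒nonZero p-prime
        t , q≡p^t = ∣p^⇒≡p^ n (*-cancelʳ-∣ {q} p (subst (q * p ∣_) (*-comm p (p ^ n)) m∣p^1+n))
    in suc t , trans (cong (_* p) q≡p^t) (*-comm (p ^ t) p)
  ... | no p∤m = ∣p^⇒≡p^ n (coprime-divisor m⊥p m∣p^1+n)
    where
    m⊥p : Coprime m p
    m⊥p (i∣m , i∣p) with prime⇒irreducible p-prime i∣p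
    ... | inj₁ i≡1 = i≡1
    ... | inj₂ refl = contradiction i∣m p∤m

  ∣m^⇒∣m : ∀ {m} n → p ∣ m ^ n → p ∣ m
  ∣m^⇒∣m zero p∣1 =
    contradiction (∣1⇒≡1 p∣1) (>⇒≢ (nonTrivial⇒n>1 p {{prime⇒nonTrivial p-prime}}))
  ∣m^⇒∣m {m} (suc n) p∣m^1+n with euclidsLemma m (m ^ n) p-prime p∣m^1+n
  ... | inj₁ p∣m   = p∣m
  ... | inj₂ p∣m^n = ∣m^⇒∣m n p∣m^n

-- The affine space V = GF(p)^d

module AffineAlgebra (p : ℕ) .{{_ : NonZero p}} (d : ℕ) where
  open Affine p d

  toℕ-mod : ∀ n → toℕ (n mod p) ≡ n % p
  toℕ-mod n = toℕ-fromℕ< _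

  mod-cong : ∀ {m n} → m % p ≡ n % p → m mod p ≡ n mod p
  mod-cong {m} {n} eq = toℕ-injective (trans (toℕ-mod m) (trans eq (sym (toℕ-mod n))))

  mod-toℕ : ∀ (a : F) → toℕ a mod p ≡ a
  mod-toℕ a = toℕ-injective (trans (toℕ-mod (toℕ a)) (m<n⇒m%n≡m (toℕ<n a)))

  -- Reduction mod p is a semiring homomorphism ℕ → F; the laws of F are transported along it.
  mod-+ : ∀ m n → (m + n) mod p ≡ (m mod p) ⊕ (n mod p)
  mod-+ m n = mod-cong (trans (%-distribˡ-+ m n p)
    (sym (cong₂ (λ x y → (x + y) % p) (toℕ-mod m) (toℕ-mod n))))

  mod-* : ∀ m n → (m * n) mod p ≡ (m mod p) ⊗ (n mod p)
  mod-* m n = mod-cong (trans (%-distribˡ-* m n p)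
    (sym (cong₂ (λ x y → (x * y) % p) (toℕ-mod m) (toℕ-mod n))))

  ⊕-comm : ∀ a b → a ⊕ b ≡ b ⊕ a
  ⊕-comm a b = cong (_mod p) (+-comm (toℕ a) (toℕ b))

  ⊗-comm : ∀ a b → a ⊗ b ≡ b ⊗ a
  ⊗-comm a b = cong (_mod p) (*-comm (toℕ a) (toℕ b))

  ⊕-assoc : ∀ a b c → (a ⊕ b) ⊕ c ≡ a ⊕ (b ⊕ c)
  ⊕-assoc a b c = begin
    (a ⊕ b) ⊕ c                             ≡⟨ cong ((a ⊕ b) ⊕_) (sym (mod-toℕ c)) ⟩
    ((toℕ a + toℕ b) mod p) ⊕ (toℕ c mod p) ≡⟨ sym (mod-+ (toℕ a + toℕ b) (toℕ c)) ⟩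
    (toℕ a + toℕ b + toℕ c) mod p           ≡⟨ cong (_mod p) (+-assoc (toℕ a) (toℕ b) (toℕ c)) ⟩
    (toℕ a + (toℕ b + toℕ c)) mod p         ≡⟨ mod-+ (toℕ a) (toℕ b + toℕ c) ⟩
    (toℕ a mod p) ⊕ (b ⊕ c)                 ≡⟨ cong (_⊕ (b ⊕ c)) (mod-toℕ a) ⟩
    a ⊕ (b ⊕ c)                             ∎
    where open ≡-Reasoning

  ⊗-assoc : ∀ a b c → (a ⊗ b) ⊗ c ≡ a ⊗ (b ⊗ c)
  ⊗-assoc a b c = begin
    (a ⊗ b) ⊗ c                             ≡⟨ cong ((a ⊗ b) ⊗_) (sym (mod-toℕ c)) ⟩
    ((toℕ a * toℕ b) mod p) ⊗ (toℕ c mod p) ≡⟨ sym (mod-* (toℕ a * toℕ b) (toℕ c)) ⟩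
    (toℕ a * toℕ b * toℕ c) mod p           ≡⟨ cong (_mod p) (*-assoc (toℕ a) (toℕ b) (toℕ c)) ⟩
    (toℕ a * (toℕ b * toℕ c)) mod p         ≡⟨ mod-* (toℕ a) (toℕ b * toℕ c) ⟩
    (toℕ a mod p) ⊗ (b ⊗ c)                 ≡⟨ cong (_⊗ (b ⊗ c)) (mod-toℕ a) ⟩
    a ⊗ (b ⊗ c)                             ∎
    where open ≡-Reasoning

  ⊗-distribˡ : ∀ a b c → a ⊗ (b ⊕ c) ≡ (a ⊗ b) ⊕ (a ⊗ c)
  ⊗-distribˡ a b c = begin
    a ⊗ (b ⊕ c)                                ≡⟨ cong (_⊗ (b ⊕ c)) (sym (mod-toℕ a)) ⟩
    (toℕ a mod p) ⊗ ((toℕ b + toℕ c) mod p)    ≡⟨ sym (mod-* (toℕ a) (toℕ b + toℕ c)) ⟩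
    (toℕ a * (toℕ b + toℕ c)) mod p            ≡⟨ cong (_mod p) (*-distribˡ-+ (toℕ a) (toℕ b) (toℕ c)) ⟩
    (toℕ a * toℕ b + toℕ a * toℕ c) mod p      ≡⟨ mod-+ (toℕ a * toℕ b) (toℕ a * toℕ c) ⟩
    (a ⊗ b) ⊕ (a ⊗ c)                          ∎
    where open ≡-Reasoning

  ⊕-identityˡ : ∀ a → 0F ⊕ a ≡ a
  ⊕-identityˡ a = trans (cong (0F ⊕_) (sym (mod-toℕ a))) (trans (sym (mod-+ 0 (toℕ a))) (mod-toℕ a))

  ⊗-identityˡ : ∀ a → 1F ⊗ a ≡ a
  ⊗-identityˡ a = trans (cong (1F ⊗_) (sym (mod-toℕ a)))
    (trans (sym (mod-* 1 (toℕ a))) (trans (cong (_mod p) (*-identityˡ (toℕ a))) (mod-toℕ a)))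

  ⊗-zeroˡ : ∀ a → 0F ⊗ a ≡ 0F
  ⊗-zeroˡ a = trans (cong (0F ⊗_) (sym (mod-toℕ a))) (sym (mod-* 0 (toℕ a)))

  ⊕-inverseʳ : ∀ a → a ⊕ (⊖ a) ≡ 0F
  ⊕-inverseʳ a = begin
    a ⊕ (⊖ a)                             ≡⟨ cong (_⊕ (⊖ a)) (sym (mod-toℕ a)) ⟩
    (toℕ a mod p) ⊕ ((p ∸ toℕ a) mod p)   ≡⟨ sym (mod-+ (toℕ a) (p ∸ toℕ a)) ⟩
    (toℕ a + (p ∸ toℕ a)) mod p           ≡⟨ cong (_mod p) (m+[n∸m]≡n (<⇒≤ (toℕ<n a))) ⟩
    p mod p                               ≡⟨ mod-cong (trans (n%n≡0 p) (sym (m<n⇒m%n≡m (>-nonZero⁻¹ p)))) ⟩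
    0F                                    ∎
    where open ≡-Reasoning

  ⊕-identityʳ : ∀ a → a ⊕ 0F ≡ a
  ⊕-identityʳ a = trans (⊕-comm a 0F) (⊕-identityˡ a)

  ⊕-inverseˡ : ∀ a → (⊖ a) ⊕ a ≡ 0F
  ⊕-inverseˡ a = trans (⊕-comm (⊖ a) a) (⊕-inverseʳ a)

  ⊗-zeroʳ : ∀ a → a ⊗ 0F ≡ 0F
  ⊗-zeroʳ a = trans (⊗-comm a 0F) (⊗-zeroˡ a)

  ⊗-distribʳ : ∀ a b c → (b ⊕ c) ⊗ a ≡ (b ⊗ a) ⊕ (c ⊗ a)
  ⊗-distribʳ a b c =
    trans (⊗-comm (b ⊕ c) a) (trans (⊗-distribˡ a b c) (cong₂ _⊕_ (⊗-comm a b) (⊗-comm a c)))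

  +ᵥ-assoc : ∀ x y z → (x +ᵥ y) +ᵥ z ≡ x +ᵥ (y +ᵥ z)
  +ᵥ-assoc = zipWith-assoc ⊕-assoc

  +ᵥ-comm : ∀ x y → x +ᵥ y ≡ y +ᵥ x
  +ᵥ-comm = zipWith-comm ⊕-comm

  +ᵥ-identityʳ : ∀ x → x +ᵥ 0ᵥ ≡ x
  +ᵥ-identityʳ = zipWith-identityʳ ⊕-identityʳ

  -ᵥ+ᵥ : ∀ x y → (x -ᵥ y) +ᵥ y ≡ x
  -ᵥ+ᵥ = go
    where
    go : ∀ {n} (x y : Vec F n) → zipWith _⊕_ (zipWith (λ a b → a ⊕ (⊖ b)) x y) y ≡ x
    go []       []       = refl
    go (a ∷ x) (b ∷ y) =
      cong₂ _∷_ (trans (⊕-assoc a (⊖ b) b) (trans (cong (a ⊕_) (⊕-inverseˡ b)) (⊕-identityʳ a))) (go x y)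

  +ᵥ-ᵥ : ∀ x y → (x +ᵥ y) -ᵥ y ≡ x
  +ᵥ-ᵥ = go
    where
    go : ∀ {n} (x y : Vec F n) → zipWith (λ a b → a ⊕ (⊖ b)) (zipWith _⊕_ x y) y ≡ x
    go []       []       = refl
    go (a ∷ x) (b ∷ y) =
      cong₂ _∷_ (trans (⊕-assoc a b (⊖ b)) (trans (cong (a ⊕_) (⊕-inverseʳ b)) (⊕-identityʳ a))) (go x y)

  +ᵥ-identityˡ : ∀ x → 0ᵥ +ᵥ x ≡ x
  +ᵥ-identityˡ x = trans (+ᵥ-comm 0ᵥ x) (+ᵥ-identityʳ x)

  -ᵥ-unique : ∀ {x y z} → z +ᵥ y ≡ x → z ≡ x -ᵥ y
  -ᵥ-unique {y = y} {z} eq = trans (sym (+ᵥ-ᵥ z y)) (cong (_-ᵥ y) eq)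

  +ᵥ-cancelʳ : ∀ {x y} z → x +ᵥ z ≡ y +ᵥ z → x ≡ y
  +ᵥ-cancelʳ {x} {y} z eq = trans (-ᵥ-unique eq) (+ᵥ-ᵥ y z)

  -ᵥ-cancelʳ : ∀ {x y} z → x -ᵥ z ≡ y -ᵥ z → x ≡ y
  -ᵥ-cancelʳ {x} {y} z eq = trans (sym (-ᵥ+ᵥ x z)) (trans (cong (_+ᵥ z) eq) (-ᵥ+ᵥ y z))

  +ᵥ-cancelˡ : ∀ {x y} z → z +ᵥ x ≡ z +ᵥ y → x ≡ y
  +ᵥ-cancelˡ {x} {y} z eq = +ᵥ-cancelʳ z (trans (+ᵥ-comm x z) (trans eq (+ᵥ-comm z y)))

  x-ᵥ0≡x : ∀ x → x -ᵥ 0ᵥ ≡ x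
  x-ᵥ0≡x x = sym (-ᵥ-unique (+ᵥ-identityʳ x))

  x-ᵥx≡0 : ∀ x → x -ᵥ x ≡ 0ᵥ
  x-ᵥx≡0 x = sym (-ᵥ-unique (+ᵥ-identityˡ x))

  x+ᵥ[y-ᵥx]≡y : ∀ x y → x +ᵥ (y -ᵥ x) ≡ y
  x+ᵥ[y-ᵥx]≡y x y = trans (+ᵥ-comm x (y -ᵥ x)) (-ᵥ+ᵥ y x)

  [x-ᵥy]+ᵥ[y-ᵥz]≡x-ᵥz : ∀ x y z → (x -ᵥ y) +ᵥ (y -ᵥ z) ≡ x -ᵥ z
  [x-ᵥy]+ᵥ[y-ᵥz]≡x-ᵥz x y z = -ᵥ-unique (begin
    ((x -ᵥ y) +ᵥ (y -ᵥ z)) +ᵥ z ≡⟨ +ᵥ-assoc (x -ᵥ y) (y -ᵥ z) z ⟩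
    (x -ᵥ y) +ᵥ ((y -ᵥ z) +ᵥ z) ≡⟨ cong ((x -ᵥ y) +ᵥ_) (-ᵥ+ᵥ y z) ⟩
    (x -ᵥ y) +ᵥ y               ≡⟨ -ᵥ+ᵥ x y ⟩
    x                           ∎)
    where open ≡-Reasoning

  +ᵥ-inverseʳ : ∀ x → x +ᵥ (0ᵥ -ᵥ x) ≡ 0ᵥ
  +ᵥ-inverseʳ x = x+ᵥ[y-ᵥx]≡y x 0ᵥ

  0-ᵥ[x-ᵥy]≡y-ᵥx : ∀ x y → 0ᵥ -ᵥ (x -ᵥ y) ≡ y -ᵥ x
  0-ᵥ[x-ᵥy]≡y-ᵥx x y = sym (-ᵥ-unique (trans ([x-ᵥy]+ᵥ[y-ᵥz]≡x-ᵥz y x y) (x-ᵥx≡0 y)))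

  [x-ᵥz]-ᵥ[y-ᵥz]≡x-ᵥy : ∀ x y z → (x -ᵥ z) -ᵥ (y -ᵥ z) ≡ x -ᵥ y
  [x-ᵥz]-ᵥ[y-ᵥz]≡x-ᵥy x y z = sym (-ᵥ-unique ([x-ᵥy]+ᵥ[y-ᵥz]≡x-ᵥz x y z))

  [z-ᵥx]-ᵥ[z-ᵥy]≡y-ᵥx : ∀ x y z → (z -ᵥ x) -ᵥ (z -ᵥ y) ≡ y -ᵥ x
  [z-ᵥx]-ᵥ[z-ᵥy]≡y-ᵥx x y z =
    sym (-ᵥ-unique (trans (+ᵥ-comm (y -ᵥ x) (z -ᵥ y)) ([x-ᵥy]+ᵥ[y-ᵥz]≡x-ᵥz z y x)))

  x-ᵥ[y+ᵥz]≡[x-ᵥz]-ᵥy : ∀ x y z → x -ᵥ (y +ᵥ z) ≡ (x -ᵥ z) -ᵥ y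
  x-ᵥ[y+ᵥz]≡[x-ᵥz]-ᵥy x y z = sym (-ᵥ-unique (begin
    ((x -ᵥ z) -ᵥ y) +ᵥ (y +ᵥ z) ≡⟨ sym (+ᵥ-assoc ((x -ᵥ z) -ᵥ y) y z) ⟩
    (((x -ᵥ z) -ᵥ y) +ᵥ y) +ᵥ z ≡⟨ cong (_+ᵥ z) (-ᵥ+ᵥ (x -ᵥ z) y) ⟩
    (x -ᵥ z) +ᵥ z               ≡⟨ -ᵥ+ᵥ x z ⟩
    x                           ∎))
    where open ≡-Reasoning

  x-ᵥ[x-ᵥy]≡y : ∀ x y → x -ᵥ (x -ᵥ y) ≡ y
  x-ᵥ[x-ᵥy]≡y x y = sym (-ᵥ-unique (x+ᵥ[y-ᵥx]≡y y x))

  [x+ᵥz]-ᵥ[x-ᵥy]≡y+ᵥz : ∀ x y z → (x +ᵥ z) -ᵥ (x -ᵥ y) ≡ y +ᵥ z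
  [x+ᵥz]-ᵥ[x-ᵥy]≡y+ᵥz x y z = sym (-ᵥ-unique (begin
    (y +ᵥ z) +ᵥ (x -ᵥ y) ≡⟨ cong (_+ᵥ (x -ᵥ y)) (+ᵥ-comm y z) ⟩
    (z +ᵥ y) +ᵥ (x -ᵥ y) ≡⟨ +ᵥ-assoc z y (x -ᵥ y) ⟩
    z +ᵥ (y +ᵥ (x -ᵥ y)) ≡⟨ cong (z +ᵥ_) (x+ᵥ[y-ᵥx]≡y y x) ⟩
    z +ᵥ x               ≡⟨ +ᵥ-comm z x ⟩
    x +ᵥ z               ∎))
    where open ≡-Reasoning

  [x+ᵥy]-ᵥx≡y : ∀ x y → (x +ᵥ y) -ᵥ x ≡ y
  [x+ᵥy]-ᵥx≡y x y = sym (-ᵥ-unique (+ᵥ-comm y x))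

  x-ᵥy≡0⇒x≡y : ∀ {x y} → x -ᵥ y ≡ 0ᵥ → x ≡ y
  x-ᵥy≡0⇒x≡y {x} {y} eq = trans (sym (-ᵥ+ᵥ x y)) (trans (cong (_+ᵥ y) eq) (+ᵥ-identityˡ y))

  x≢x+ᵥc : ∀ {x c} → c ≢ 0ᵥ → x ≢ x +ᵥ c
  x≢x+ᵥc {x} c≢0 x≡x+c = c≢0 (+ᵥ-cancelˡ x (trans (sym x≡x+c) (sym (+ᵥ-identityʳ x))))

  [x+ᵥy]+ᵥz≡[x+ᵥz]+ᵥy : ∀ x y z → (x +ᵥ y) +ᵥ z ≡ (x +ᵥ z) +ᵥ y
  [x+ᵥy]+ᵥz≡[x+ᵥz]+ᵥy x y z =
    trans (+ᵥ-assoc x y z) (trans (cong (x +ᵥ_) (+ᵥ-comm y z)) (sym (+ᵥ-assoc x z y)))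

  [x+ᵥy]-ᵥz≡x+ᵥ[y-ᵥz] : ∀ x y z → (x +ᵥ y) -ᵥ z ≡ x +ᵥ (y -ᵥ z)
  [x+ᵥy]-ᵥz≡x+ᵥ[y-ᵥz] x y z =
    sym (-ᵥ-unique (trans (+ᵥ-assoc x (y -ᵥ z) z) (cong (x +ᵥ_) (-ᵥ+ᵥ y z))))

  [x+ᵥy]-ᵥz≡[x-ᵥz]+ᵥy : ∀ x y z → (x +ᵥ y) -ᵥ z ≡ (x -ᵥ z) +ᵥ y
  [x+ᵥy]-ᵥz≡[x-ᵥz]+ᵥy x y z =
    trans (cong (_-ᵥ z) (+ᵥ-comm x y)) (trans ([x+ᵥy]-ᵥz≡x+ᵥ[y-ᵥz] y x z) (+ᵥ-comm y (x -ᵥ z)))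

  module _ (p≡2 : p ≡ 2) where

    x+ᵥx≡0 : ∀ x → x +ᵥ x ≡ 0ᵥ
    x+ᵥx≡0 = go
      where
      a⊕a≡0 : ∀ a → a ⊕ a ≡ 0F
      a⊕a≡0 a = mod-cong (begin
        (toℕ a + toℕ a) % p ≡⟨ cong (λ n → (toℕ a + n) % p) (sym (+-identityʳ (toℕ a))) ⟩
        (2 * toℕ a) % p     ≡⟨ cong (_% p) (trans (*-comm 2 (toℕ a)) (cong (toℕ a *_) (sym p≡2))) ⟩
        (toℕ a * p) % p     ≡⟨ m*n%n≡0 (toℕ a) p ⟩
        0                   ≡⟨ sym (m<n⇒m%n≡m (>-nonZero⁻¹ p)) ⟩
        0 % p               ∎)
        where open ≡-Reasoning
      go : ∀ {n} (x : Vec F n) → zipWith _⊕_ x x ≡ replicate n 0F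
      go []      = refl
      go (a ∷ x) = cong₂ _∷_ (a⊕a≡0 a) (go x)

    [x-ᵥz]+ᵥ[y-ᵥz]≡x+ᵥy : ∀ x y z → (x -ᵥ z) +ᵥ (y -ᵥ z) ≡ x +ᵥ y
    [x-ᵥz]+ᵥ[y-ᵥz]≡x+ᵥy x y z = begin
      (x -ᵥ z) +ᵥ (y -ᵥ z) ≡⟨ sym ([x+ᵥy]-ᵥz≡x+ᵥ[y-ᵥz] (x -ᵥ z) y z) ⟩
      ((x -ᵥ z) +ᵥ y) -ᵥ z ≡⟨ cong (_-ᵥ z) (sym ([x+ᵥy]-ᵥz≡[x-ᵥz]+ᵥy x y z)) ⟩
      ((x +ᵥ y) -ᵥ z) -ᵥ z ≡⟨ sym (x-ᵥ[y+ᵥz]≡[x-ᵥz]-ᵥy (x +ᵥ y) z z) ⟩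
      (x +ᵥ y) -ᵥ (z +ᵥ z) ≡⟨ cong ((x +ᵥ y) -ᵥ_) (x+ᵥx≡0 z) ⟩
      (x +ᵥ y) -ᵥ 0ᵥ       ≡⟨ x-ᵥ0≡x (x +ᵥ y) ⟩
      x +ᵥ y               ∎
      where open ≡-Reasoning

  private
    ⊕-interchange : ∀ a b c e → (a ⊕ b) ⊕ (c ⊕ e) ≡ (a ⊕ c) ⊕ (b ⊕ e)
    ⊕-interchange a b c e = begin
      (a ⊕ b) ⊕ (c ⊕ e) ≡⟨ ⊕-assoc a b (c ⊕ e) ⟩
      a ⊕ (b ⊕ (c ⊕ e)) ≡⟨ cong (a ⊕_) (sym (⊕-assoc b c e)) ⟩
      a ⊕ ((b ⊕ c) ⊕ e) ≡⟨ cong (λ z → a ⊕ (z ⊕ e)) (⊕-comm b c) ⟩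
      a ⊕ ((c ⊕ b) ⊕ e) ≡⟨ cong (a ⊕_) (⊕-assoc c b e) ⟩
      a ⊕ (c ⊕ (b ⊕ e)) ≡⟨ sym (⊕-assoc a c (b ⊕ e)) ⟩
      (a ⊕ c) ⊕ (b ⊕ e) ∎
      where open ≡-Reasoning

    mul : ∀ {m n} → Vec (Vec F n) m → Vec F n → Vec F m
    mul A x = Vec.map (λ row → dot row x) A

    dot-zeroˡ : ∀ {n} (x : Vec F n) → dot (replicate n 0F) x ≡ 0F
    dot-zeroˡ []      = refl
    dot-zeroˡ (b ∷ x) = trans (cong₂ _⊕_ (⊗-zeroˡ b) (dot-zeroˡ x)) (⊕-identityˡ 0F)

    dot-zeroʳ : ∀ {n} (u : Vec F n) → dot u (replicate n 0F) ≡ 0F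
    dot-zeroʳ []      = refl
    dot-zeroʳ (a ∷ u) = trans (cong₂ _⊕_ (⊗-zeroʳ a) (dot-zeroʳ u)) (⊕-identityˡ 0F)

    dot-distribˡ : ∀ {n} (u x y : Vec F n) → dot u (zipWith _⊕_ x y) ≡ dot u x ⊕ dot u y
    dot-distribˡ []      []      []      = sym (⊕-identityˡ 0F)
    dot-distribˡ (a ∷ u) (b ∷ x) (c ∷ y) =
      trans (cong₂ _⊕_ (⊗-distribˡ a b c) (dot-distribˡ u x y))
            (⊕-interchange (a ⊗ b) (a ⊗ c) (dot u x) (dot u y))

    dot-distribʳ : ∀ {n} (u w x : Vec F n) → dot (zipWith _⊕_ u w) x ≡ dot u x ⊕ dot w x
    dot-distribʳ []      []      []      = sym (⊕-identityˡ 0F)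
    dot-distribʳ (a ∷ u) (c ∷ w) (b ∷ x) =
      trans (cong₂ _⊕_ (⊗-distribʳ b a c) (dot-distribʳ u w x))
            (⊕-interchange (a ⊗ b) (c ⊗ b) (dot u x) (dot w x))

    dot-scaleˡ : ∀ {n} c (u x : Vec F n) → dot (Vec.map (_⊗ c) u) x ≡ c ⊗ dot u x
    dot-scaleˡ c []      []      = sym (⊗-zeroʳ c)
    dot-scaleˡ c (a ∷ u) (b ∷ x) =
      trans (cong₂ _⊕_ ac·b≡c·ab (dot-scaleˡ c u x)) (sym (⊗-distribˡ c (a ⊗ b) (dot u x)))
      where
      ac·b≡c·ab : (a ⊗ c) ⊗ b ≡ c ⊗ (a ⊗ b)
      ac·b≡c·ab = trans (cong (_⊗ b) (⊗-comm a c)) (⊗-assoc c a b)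

    transpose-∷ : ∀ {m n} (r : Vec F n) (A : Vec (Vec F n) m) →
                  transpose (r ∷ A) ≡ zipWith _∷_ r (transpose A)
    transpose-∷ r A = go r (transpose A)
      where
      go : ∀ {m n} (r : Vec F n) (C : Vec (Vec F m) n) → ((replicate n _∷_ ⊛ r) ⊛ C) ≡ zipWith _∷_ r C
      go []      []      = refl
      go (a ∷ r) (c ∷ C) = cong ((a ∷ c) ∷_) (go r C)

    mul-zipWith-∷ : ∀ {m n} a (x : Vec F m) (r : Vec F n) (C : Vec (Vec F m) n) →
                    mul (zipWith _∷_ r C) (a ∷ x) ≡ zipWith _⊕_ (Vec.map (_⊗ a) r) (mul C x)
    mul-zipWith-∷ a x []      []      = refl
    mul-zipWith-∷ a x (b ∷ r) (c ∷ C) = cong (_ ∷_) (mul-zipWith-∷ a x r C)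

    dot-mul-transpose : ∀ {m n} (A : Vec (Vec F n) m) (u : Vec F m) (x : Vec F n) →
                        dot (mul (transpose A) u) x ≡ dot u (mul A x)
    dot-mul-transpose {n = n} [] [] x =
      trans (cong (λ z → dot z x) (map-replicate (λ row → dot row []) [] n)) (dot-zeroˡ x)
    dot-mul-transpose (r ∷ A) (a ∷ u) x = begin
      dot (mul (transpose (r ∷ A)) (a ∷ u)) x
        ≡⟨ cong (λ C → dot (mul C (a ∷ u)) x) (transpose-∷ r A) ⟩
      dot (mul (zipWith _∷_ r (transpose A)) (a ∷ u)) x
        ≡⟨ cong (λ z → dot z x) (mul-zipWith-∷ a u r (transpose A)) ⟩
      dot (zipWith _⊕_ (Vec.map (_⊗ a) r) (mul (transpose A) u)) x
        ≡⟨ dot-distribʳ (Vec.map (_⊗ a) r) (mul (transpose A) u) x ⟩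
      dot (Vec.map (_⊗ a) r) x ⊕ dot (mul (transpose A) u) x
        ≡⟨ cong₂ _⊕_ (dot-scaleˡ a r x) (dot-mul-transpose A u x) ⟩
      (a ⊗ dot r x) ⊕ dot u (mul A x) ∎
      where open ≡-Reasoning

    dot-δ : ∀ {n} (i : Fin n) (x : Vec F n) →
            dot (tabulate (λ j → if does (i Fin.≟ j) then 1F else 0F)) x ≡ Vec.lookup x i
    dot-δ Fin.zero    (b ∷ x) =
      trans (cong₂ _⊕_ (⊗-identityˡ b) (trans (cong (λ z → dot z x) (tabulate-const 0F)) (dot-zeroˡ x)))
            (⊕-identityʳ b)
      where
      tabulate-const : ∀ {n} (c : F) → tabulate {n = n} (λ _ → c) ≡ replicate n c
      tabulate-const {zero}  c = refl
      tabulate-const {suc n} c = cong (c ∷_) (tabulate-const c)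
    dot-δ (Fin.suc i) (b ∷ x) = trans (cong₂ _⊕_ (⊗-zeroˡ b) (dot-δ i x)) (⊕-identityˡ _)

  applyM-+ : ∀ A x y → applyM A (x +ᵥ y) ≡ applyM A x +ᵥ applyM A y
  applyM-+ A x y = go A
    where
    go : ∀ {m} (A : Vec V m) → mul A (x +ᵥ y) ≡ zipWith _⊕_ (mul A x) (mul A y)
    go []      = refl
    go (r ∷ A) = cong₂ _∷_ (dot-distribˡ r x y) (go A)

  applyM-0 : ∀ A → applyM A 0ᵥ ≡ 0ᵥ
  applyM-0 A = trans (map-cong dot-zeroʳ A) (map-const A 0F)

  applyM-id : ∀ x → applyM idM x ≡ x
  applyM-id x =
    trans (sym (tabulate-∘ (λ row → dot row x) _)) (trans (tabulate-cong (λ i → dot-δ i x)) (tabulate∘lookup x))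

  applyM-∘M : ∀ M A x → applyM (M ∘M A) x ≡ applyM M (applyM A x)
  applyM-∘M M A x =
    trans (sym (map-∘ (λ row → dot row x) (mul (transpose A)) M)) (map-cong (λ u → dot-mul-transpose A u x) M)

  ⟦translation⟧ : ∀ c x → ⟦ translation c ⟧ x ≡ x +ᵥ c
  ⟦translation⟧ c x = cong (_+ᵥ c) (applyM-id x)

  invertible⇒injective : ∀ {A} → Invertible A → ∀ {x y} → applyM A x ≡ applyM A y → x ≡ y
  invertible⇒injective {A} (M , M∘A≡id) {x} {y} Ax≡Ay = begin
    x                     ≡⟨ sym (applyM-id x) ⟩
    applyM idM x          ≡⟨ cong (λ N → applyM N x) (sym M∘A≡id) ⟩
    applyM (M ∘M A) x     ≡⟨ applyM-∘M M A x ⟩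
    applyM M (applyM A x) ≡⟨ cong (applyM M) Ax≡Ay ⟩
    applyM M (applyM A y) ≡⟨ sym (applyM-∘M M A y) ⟩
    applyM (M ∘M A) y     ≡⟨ cong (λ N → applyM N y) M∘A≡id ⟩
    applyM idM y          ≡⟨ applyM-id y ⟩
    y                     ∎
    where open ≡-Reasoning

  private
    allVec≡product : ∀ n → allVec (suc n) ≡ cartesianProductWith Vec._∷_ (allFin p) (allVec n)
    allVec≡product n = go (allFin p)
      where
      go : ∀ as → concatMap (λ a → map (a ∷_) (allVec n)) as ≡ cartesianProductWith Vec._∷_ as (allVec n)
      go []       = refl
      go (a ∷ as) = cong (map (a ∷_) (allVec n) ++_) (go as)

    allVec-complete : ∀ {n} (x : Vec F n) → x ∈ allVec n
    allVec-complete []      = here refl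
    allVec-complete (a ∷ x) =
      subst ((a ∷ x) ∈_) (sym (allVec≡product _))
            (∈-cartesianProductWith⁺ Vec._∷_ (∈-allFin a) (allVec-complete x))

    allVec-unique : ∀ n → Unique (allVec n)
    allVec-unique zero    = [] ∷ []
    allVec-unique (suc n) =
      subst Unique (sym (allVec≡product n))
            (Unique.cartesianProductWith⁺ Vec._∷_ ∷-injective (allFin⁺ p) (allVec-unique n))

    length-allVec : ∀ n → length (allVec n) ≡ p ^ n
    length-allVec zero    = refl
    length-allVec (suc n) = begin
      length (allVec (suc n))                                     ≡⟨ cong length (allVec≡product n) ⟩
      length (cartesianProductWith Vec._∷_ (allFin p) (allVec n)) ≡⟨ length-cartesianProductWith _ (allFin p) _ ⟩
      length (allFin p) * length (allVec n)                       ≡⟨ cong (_* length (allVec n)) (length-tabulate {n = p} id) ⟩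
      p * length (allVec n)                                       ≡⟨ cong (p *_) (length-allVec n) ⟩
      p * p ^ n                                                   ∎
      where open ≡-Reasoning

  _≟ᵥ_ : DecidableEquality V
  _≟ᵥ_ = ≡-dec Fin._≟_

  Vᴱ : Enumeration V
  Vᴱ = record { _≟_ = _≟ᵥ_ ; elements = allV ; unique = allVec-unique d ; complete = allVec-complete }

  length-allV : length allV ≡ p ^ d
  length-allV = length-allVec d

  infix 10 #_
  #_ : (V → Bool) → ℕ
  # P = count Vᴱ P

  #-translate : ∀ P a → # (λ y → P (y -ᵥ a)) ≡ # P
  #-translate P a = ≤-antisym
    (count-≤-injection Vᴱ Vᴱ {h = _-ᵥ a} (-ᵥ-cancelʳ a) id)
    (count-≤-injection Vᴱ Vᴱ {h = _+ᵥ a} (+ᵥ-cancelʳ a) (λ {x} Px → subst-true P (sym (+ᵥ-ᵥ x a)) Px))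

  -- Additive subgroups of V

  record IsAdditiveSubgroup (Q : V → Bool) : Set where
    field
      0∈ : Q 0ᵥ ≡ true
      +∈ : ∀ {x y} → Q x ≡ true → Q y ≡ true → Q (x +ᵥ y) ≡ true
      -∈ : ∀ {x y} → Q x ≡ true → Q y ≡ true → Q (x -ᵥ y) ≡ true

  ∩-isAdditiveSubgroup : ∀ {Q Q'} → IsAdditiveSubgroup Q → IsAdditiveSubgroup Q' →
                         IsAdditiveSubgroup (λ x → Q x ∧ Q' x)
  ∩-isAdditiveSubgroup Q-sub Q'-sub = record
    { 0∈ = cong₂ _∧_ Q.0∈ Q'.0∈
    ; +∈ = λ x∈ y∈ → cong₂ _∧_ (Q.+∈ (∧-conicalˡ _ _ x∈) (∧-conicalˡ _ _ y∈))
                               (Q'.+∈ (∧-conicalʳ _ _ x∈) (∧-conicalʳ _ _ y∈))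
    ; -∈ = λ x∈ y∈ → cong₂ _∧_ (Q.-∈ (∧-conicalˡ _ _ x∈) (∧-conicalˡ _ _ y∈))
                               (Q'.-∈ (∧-conicalʳ _ _ x∈) (∧-conicalʳ _ _ y∈))
    }
    where
    module Q  = IsAdditiveSubgroup Q-sub
    module Q' = IsAdditiveSubgroup Q'-sub

  private
    0·ᵥ : ∀ x → (0 mod p) ·ᵥ x ≡ 0ᵥ
    0·ᵥ x = trans (map-cong ⊗-zeroˡ x) (map-const x 0F)

    1+n·ᵥ : ∀ n x → (suc n mod p) ·ᵥ x ≡ x +ᵥ ((n mod p) ·ᵥ x)
    1+n·ᵥ n = go
      where
      1+n⊗ : ∀ c → (suc n mod p) ⊗ c ≡ c ⊕ ((n mod p) ⊗ c)
      1+n⊗ c = begin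
        (suc n mod p) ⊗ c                     ≡⟨ cong ((suc n mod p) ⊗_) (sym (mod-toℕ c)) ⟩
        (suc n mod p) ⊗ (toℕ c mod p)         ≡⟨ sym (mod-* (suc n) (toℕ c)) ⟩
        (toℕ c + n * toℕ c) mod p             ≡⟨ mod-+ (toℕ c) (n * toℕ c) ⟩
        (toℕ c mod p) ⊕ ((n * toℕ c) mod p)   ≡⟨ cong₂ _⊕_ (mod-toℕ c) (mod-* n (toℕ c)) ⟩
        c ⊕ ((n mod p) ⊗ (toℕ c mod p))       ≡⟨ cong (λ z → c ⊕ ((n mod p) ⊗ z)) (mod-toℕ c) ⟩
        c ⊕ ((n mod p) ⊗ c)                   ∎
        where open ≡-Reasoning
      go : ∀ {m} (x : Vec F m) → Vec.map ((suc n mod p) ⊗_) x ≡ zipWith _⊕_ x (Vec.map ((n mod p) ⊗_) x)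
      go []      = refl
      go (c ∷ x) = cong₂ _∷_ (1+n⊗ c) (go x)

  +-closed⇒subspace : ∀ {W} → W 0ᵥ ≡ true → (∀ {x y} → W x ≡ true → W y ≡ true → W (x +ᵥ y) ≡ true) →
                      IsSubspace W
  +-closed⇒subspace {W} W0 W+ =
    W0 , (λ _ _ → W+) , λ a x Wx → subst-true (λ b → W (b ·ᵥ x)) (mod-toℕ a) (closed (toℕ a) Wx)
    where
    closed : ∀ n {x} → W x ≡ true → W ((n mod p) ·ᵥ x) ≡ true
    closed zero    {x} _  = subst-true W (sym (0·ᵥ x)) W0
    closed (suc n) {x} Wx = subst-true W (sym (1+n·ᵥ n x)) (W+ Wx (closed n Wx))

  subgroup⇒subspace : ∀ {Q} → IsAdditiveSubgroup Q → IsSubspace Q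
  subgroup⇒subspace Q-subgroup = +-closed⇒subspace 0∈ +∈
    where open IsAdditiveSubgroup Q-subgroup

  module _ (p≡2 : p ≡ 2) {Q} (Q-subgroup : IsAdditiveSubgroup Q) (w : V) where
    open IsAdditiveSubgroup Q-subgroup

    private
      ∈Q : ∀ {z} → Q z ≡ true → (Q z ∨ Q (z -ᵥ w)) ≡ true
      ∈Q {z} Qz = cong (_∨ Q (z -ᵥ w)) Qz

      ∈w+Q : ∀ {z} → Q (z -ᵥ w) ≡ true → (Q z ∨ Q (z -ᵥ w)) ≡ true
      ∈w+Q {z} Q[z-w] = trans (cong (Q z ∨_) Q[z-w]) (∨-zeroʳ (Q z))

    subgroup-∪-coset-+-closed : ∀ {x y} → (Q x ∨ Q (x -ᵥ w)) ≡ true → (Q y ∨ Q (y -ᵥ w)) ≡ true →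
                                (Q (x +ᵥ y) ∨ Q ((x +ᵥ y) -ᵥ w)) ≡ true
    subgroup-∪-coset-+-closed {x} {y} x∈ y∈ with ∨-true⁻ x∈ | ∨-true⁻ y∈
    ... | inj₁ Qx     | inj₁ Qy     = ∈Q (+∈ Qx Qy)
    ... | inj₁ Qx     | inj₂ Q[y-w] = ∈w+Q (subst-true Q (sym ([x+ᵥy]-ᵥz≡x+ᵥ[y-ᵥz] x y w)) (+∈ Qx Q[y-w]))
    ... | inj₂ Q[x-w] | inj₁ Qy     = ∈w+Q (subst-true Q (sym ([x+ᵥy]-ᵥz≡[x-ᵥz]+ᵥy x y w)) (+∈ Q[x-w] Qy))
    ... | inj₂ Q[x-w] | inj₂ Q[y-w] = ∈Q (subst-true Q ([x-ᵥz]+ᵥ[y-ᵥz]≡x+ᵥy p≡2 x y w) (+∈ Q[x-w] Q[y-w]))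

    subgroup-∪-coset-isSubspace : IsSubspace (λ z → Q z ∨ Q (z -ᵥ w))
    subgroup-∪-coset-isSubspace = +-closed⇒subspace (∈Q 0∈) subgroup-∪-coset-+-closed

  module TranslationAction {X : Set} (act : V → X → X)
    (act-0 : ∀ x → act 0ᵥ x ≡ x) (act-+ : ∀ a b x → act (a +ᵥ b) x ≡ act b (act a x)) where

    act-injective : ∀ a {x y} → act a x ≡ act a y → x ≡ y
    act-injective a {x} {y} eq = begin
      x                           ≡⟨ sym (act-0 x) ⟩
      act 0ᵥ x                    ≡⟨ cong (λ c → act c x) (sym (+ᵥ-inverseʳ a)) ⟩
      act (a +ᵥ (0ᵥ -ᵥ a)) x      ≡⟨ act-+ a (0ᵥ -ᵥ a) x ⟩
      act (0ᵥ -ᵥ a) (act a x)     ≡⟨ cong (act (0ᵥ -ᵥ a)) eq ⟩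
      act (0ᵥ -ᵥ a) (act a y)     ≡⟨ sym (act-+ a (0ᵥ -ᵥ a) y) ⟩
      act (a +ᵥ (0ᵥ -ᵥ a)) y      ≡⟨ cong (λ c → act c y) (+ᵥ-inverseʳ a) ⟩
      act 0ᵥ y                    ≡⟨ act-0 y ⟩
      y                           ∎
      where open ≡-Reasoning

    act-solve : ∀ {a a' x y} → act a y ≡ act a' x → y ≡ act (a' -ᵥ a) x
    act-solve {a} {a'} {x} {y} eq = act-injective a (begin
      act a y                     ≡⟨ eq ⟩
      act a' x                    ≡⟨ cong (λ c → act c x) (sym (-ᵥ+ᵥ a' a)) ⟩
      act ((a' -ᵥ a) +ᵥ a) x      ≡⟨ act-+ (a' -ᵥ a) a x ⟩
      act a (act (a' -ᵥ a) x)     ∎)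
      where open ≡-Reasoning

    module Orbits (E : Enumeration X) (free : ∀ {a b x} → act a x ≡ act b x → a ≡ b)
                  {Q} (Q-subgroup : IsAdditiveSubgroup Q) where
      open IsAdditiveSubgroup Q-subgroup
      open Enumeration E using (_≟_)

      Invariant : (X → Bool) → Set
      Invariant P = ∀ {a x} → Q a ≡ true → P x ≡ true → P (act a x) ≡ true

      orbit? : ∀ x y → Dec (∃ λ a → Q a ≡ true × act a x ≡ y)
      orbit? x y = ∃? Vᴱ (λ a → (Q a Bool.≟ true) ×-dec (act a x ≟ y))

      orbit : X → X → Bool
      orbit x y = does (orbit? x y)

      orbit⁺ : ∀ {a x} → Q a ≡ true → orbit x (act a x) ≡ true
      orbit⁺ {a} {x} Qa = dec-true (orbit? x (act a x)) (a , Qa , refl)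

      orbit⁻ : ∀ {x y} → orbit x y ≡ true → ∃ λ a → Q a ≡ true × act a x ≡ y
      orbit⁻ {x} {y} = does⇒ (orbit? x y)

      #Q>0 : 0 < # Q
      #Q>0 = length≤count Vᴱ ([] ∷ []) λ { (here refl) → 0∈ }

      count-orbit : ∀ x → count E (orbit x) ≡ # Q
      count-orbit x = ≤-antisym
        (subst (count E (orbit x) ≤_) (length-map (λ a → act a x) (filterᵇ Q allV))
          (count≤length E λ o → let a , Qa , eq = orbit⁻ o in
            subst (_∈ _) eq (∈-map⁺ (λ a → act a x) (∈-filterᵇ⁺ Q (Enumeration.complete Vᴱ a) Qa))))
        (count-≤-injection Vᴱ E {h = λ a → act a x} free orbit⁺)

      _∖orbit_ : (X → Bool) → X → X → Bool
      (P ∖orbit x) y = P y ∧ not (orbit x y)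

      outside-orbit-invariant : ∀ {P} x → Invariant P → Invariant (P ∖orbit x)
      outside-orbit-invariant {P} x P-inv {a} {y} Qa Py∧y∉ with orbit x (act a y) in ay∈
      ... | false = cong₂ _∧_ (P-inv Qa (∧-conicalˡ _ _ Py∧y∉)) refl
      ... | true  = ⊥-elim (not-¬ (∧-conicalʳ _ _ Py∧y∉) (cong not y∈))
        where
        y∈ : orbit x y ≡ true
        y∈ = let a' , Qa' , a'x≡ay = orbit⁻ ay∈ in
             subst-true (orbit x) (sym (act-solve (sym a'x≡ay))) (orbit⁺ (-∈ Qa' Qa))

      count-remove-orbit : ∀ {P x} → Invariant P → P x ≡ true → count E P ≡ # Q + count E (P ∖orbit x)
      count-remove-orbit {P} {x} P-inv Px = begin
        count E P                                    ≡⟨ count-cong E split ⟩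
        count E (λ y → orbit x y ∨ (P ∖orbit x) y)   ≡⟨ count-∨ E disjoint ⟩
        count E (orbit x) + count E (P ∖orbit x)     ≡⟨ cong (_+ count E (P ∖orbit x)) (count-orbit x) ⟩
        # Q + count E (P ∖orbit x)                   ∎
        where
        open ≡-Reasoning
        split : ∀ y → P y ≡ (orbit x y ∨ (P ∖orbit x) y)
        split y with orbit x y in y∈
        ... | true  = let a , Qa , ax≡y = orbit⁻ y∈ in subst-true P ax≡y (P-inv Qa Px)
        ... | false = sym (∧-identityʳ (P y))
        disjoint : ∀ y → orbit x y ≡ true → (P ∖orbit x) y ≡ true → ⊥
        disjoint y y∈ rest = not-¬ (∧-conicalʳ _ _ rest) (cong not y∈)

      #Q∣count : ∀ {P} → Invariant P → # Q ∣ count E P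
      #Q∣count {P} = go (suc (count E P)) ≤-refl
        where
        -- Removing one orbit, of size # Q, leaves a smaller invariant set.
        go : ∀ n {P} → count E P < n → Invariant P → # Q ∣ count E P
        go (suc n) {P} P<1+n P-inv with 0 <? count E P
        ... | no  P≯0 = subst (# Q ∣_) (sym (n≤0⇒n≡0 (≮⇒≥ P≯0))) ((# Q) ∣0)
        ... | yes P>0 =
          let x , Px = count-witness E P>0
              P≡ = count-remove-orbit {x = x} P-inv Px
              rest<n = ≤-trans (+-monoˡ-≤ _ #Q>0) (≤-trans (≤-reflexive (sym P≡)) (s≤s⁻¹ P<1+n))
          in subst (# Q ∣_) (sym P≡) (∣m∣n⇒∣m+n ∣-refl (go n rest<n (outside-orbit-invariant {P} x P-inv)))

  module _ {Q} (Q-subgroup : IsAdditiveSubgroup Q) where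
    open TranslationAction (λ a x → x +ᵥ a) +ᵥ-identityʳ (λ a b x → sym (+ᵥ-assoc x a b))
    open Orbits Vᴱ (λ {_} {_} {x} → +ᵥ-cancelˡ x) Q-subgroup

    lagrange : ∀ {P} → (∀ {a x} → Q a ≡ true → P x ≡ true → P (x +ᵥ a) ≡ true) → # Q ∣ # P
    lagrange = #Q∣count

  -- Blocks of a design on V

  module _ {b} (B : Fin b → V → Bool) (balanced : Balanced B 2) {x y : V} (x≢y : x ≢ y) where

    private
      Through : Fin b → Bool
      Through i = B i x ∧ B i y

    other-blocks-through-pair-coincide : ∀ {i j k} → Through i ≡ true → Through j ≡ true → Through k ≡ true →
                                         i ≢ j → i ≢ k → j ≡ k
    other-blocks-through-pair-coincide {i} {j} {k} i∋ j∋ k∋ i≢j i≢k with j Fin.≟ k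
    ... | yes j≡k = j≡k
    ... | no  j≢k = contradiction (subst (3 ≤_) (balanced x y x≢y) three≤) λ { (s≤s (s≤s ())) }
      where
      three≤ : 3 ≤ count (Finᴱ b) Through
      three≤ = length≤count (Finᴱ b) ((i≢j ∷ i≢k ∷ []) ∷ (j≢k ∷ []) ∷ [] ∷ [])
        λ { (here refl) → i∋ ; (there (here refl)) → j∋ ; (there (there (here refl))) → k∋ }

    another-block-through-pair : ∀ {i} → Through i ≡ true → ∃ λ j → j ≢ i × Through j ≡ true
    another-block-through-pair {i} i∋ with ∃? (Finᴱ b) (λ j → ¬? (j Fin.≟ i) ×-dec (Through j Bool.≟ true))
    ... | yes j,j≢i,j∋ = j,j≢i,j∋
    ... | no  ∄j =
      contradiction (subst (_≤ 1) (balanced x y x≢y) (count≤length (Finᴱ b) only-i)) λ { (s≤s ()) }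
      where
      only-i : ∀ {j} → Through j ≡ true → j ∈ i ∷ []
      only-i {j} j∋ with j Fin.≟ i
      ... | yes refl = here refl
      ... | no  j≢i  = contradiction (j , j≢i , j∋) ∄j

  module TranslatedBlocks {b} (B : Fin b → V → Bool) (distinct : DistinctBlocks B)
                          (translates : ∀ c i → ∃ λ j → MapsBlock B (translation c) i j) where

    translate : V → Fin b → Fin b
    translate c i = proj₁ (translates c i)

    ∈-translate : ∀ c i y → B (translate c i) y ≡ B i (y -ᵥ c)
    ∈-translate c i y = trans (cong (B (translate c i)) (sym shift)) (proj₂ (translates c i) (y -ᵥ c))
      where
      shift : ⟦ translation c ⟧ (y -ᵥ c) ≡ y
      shift = trans (⟦translation⟧ c (y -ᵥ c)) (-ᵥ+ᵥ y c)

    translate-0 : ∀ i → translate 0ᵥ i ≡ i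
    translate-0 i = distinct _ _ λ y → trans (∈-translate 0ᵥ i y) (cong (B i) (x-ᵥ0≡x y))

    translate-+ : ∀ a c i → translate (a +ᵥ c) i ≡ translate c (translate a i)
    translate-+ a c i = distinct _ _ λ y → begin
      B (translate (a +ᵥ c) i) y        ≡⟨ ∈-translate (a +ᵥ c) i y ⟩
      B i (y -ᵥ (a +ᵥ c))               ≡⟨ cong (B i) (x-ᵥ[y+ᵥz]≡[x-ᵥz]-ᵥy y a c) ⟩
      B i ((y -ᵥ c) -ᵥ a)               ≡⟨ sym (∈-translate a i (y -ᵥ c)) ⟩
      B (translate a i) (y -ᵥ c)        ≡⟨ sym (∈-translate c (translate a i) y) ⟩
      B (translate c (translate a i)) y ∎
      where open ≡-Reasoning

    open TranslationAction translate translate-0 translate-+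

    Stab : Fin b → V → Bool
    Stab i c = does (translate c i Fin.≟ i)

    Stab⁺ : ∀ {i c} → translate c i ≡ i → Stab i c ≡ true
    Stab⁺ {i} {c} = dec-true (translate c i Fin.≟ i)

    Stab⁻ : ∀ {i c} → Stab i c ≡ true → translate c i ≡ i
    Stab⁻ {i} {c} = does⇒ (translate c i Fin.≟ i)

    Stab-isAdditiveSubgroup : ∀ i → IsAdditiveSubgroup (Stab i)
    Stab-isAdditiveSubgroup i = record
      { 0∈ = Stab⁺ (translate-0 i)
      ; +∈ = λ {x} {y} Sx Sy →
               Stab⁺ (trans (translate-+ x y i) (trans (cong (translate y) (Stab⁻ Sx)) (Stab⁻ Sy)))
      ; -∈ = λ Sx Sy → Stab⁺ (sym (act-solve (trans (Stab⁻ Sy) (sym (Stab⁻ Sx)))))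
      }

    Stab-sym : ∀ {i x y} → Stab i (x -ᵥ y) ≡ true → Stab i (y -ᵥ x) ≡ true
    Stab-sym {i} {x} {y} S = subst-true (Stab i) (0-ᵥ[x-ᵥy]≡y-ᵥx x y) (-∈ 0∈ S)
      where open IsAdditiveSubgroup (Stab-isAdditiveSubgroup i)

    Stab-invariant : ∀ {i c} → Stab i c ≡ true → ∀ y → B i (y +ᵥ c) ≡ B i y
    Stab-invariant {i} {c} S y = begin
      B i (y +ᵥ c)               ≡⟨ cong (λ j → B j (y +ᵥ c)) (sym (Stab⁻ S)) ⟩
      B (translate c i) (y +ᵥ c) ≡⟨ ∈-translate c i (y +ᵥ c) ⟩
      B i ((y +ᵥ c) -ᵥ c)        ≡⟨ cong (B i) (+ᵥ-ᵥ y c) ⟩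
      B i y                      ∎
      where open ≡-Reasoning

    coset⊆block : ∀ {i a y} → B i a ≡ true → Stab i (y -ᵥ a) ≡ true → B i y ≡ true
    coset⊆block {i} {a} {y} Ba S = trans (cong (B i) (sym (x+ᵥ[y-ᵥx]≡y a y))) (trans (Stab-invariant S a) Ba)

    +-closed⇒Stab : ∀ {i c} → (∀ {y} → B i y ≡ true → B i (y +ᵥ c) ≡ true) → Stab i c ≡ true
    +-closed⇒Stab {i} {c} closed =
      Stab⁺ (distinct _ _ λ y → trans (∈-translate c i y) (Bool-ext (back y) (forth y)))
      where
      -- The injection (_+ᵥ c) maps the finite set B i into, hence onto, itself.
      back : ∀ y → B i (y -ᵥ c) ≡ true → B i y ≡ true
      back y B[y-c] = subst-true (B i) (-ᵥ+ᵥ y c) (closed B[y-c])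
      forth : ∀ y → B i y ≡ true → B i (y -ᵥ c) ≡ true
      forth y By with injection-onto Vᴱ Vᴱ (+ᵥ-cancelʳ c) closed ≤-refl {y} By
      ... | x , Bx , refl = subst-true (B i) (sym (+ᵥ-ᵥ x c)) Bx

    Coset : Fin b → V → Set
    Coset i a = ∀ y → B i y ≡ Stab i (y -ᵥ a)

    TwoCosets : Fin b → V → V → Set
    TwoCosets i a a' = ∀ y → B i y ≡ (Stab i (y -ᵥ a) ∨ Stab i (y -ᵥ a'))

    coset-recentre : ∀ {i a a'} → Coset i a → B i a' ≡ true → Coset i a'
    coset-recentre {i} {a} {a'} B≡ Ba' y = Bool-ext
      (λ By → subst-true (Stab i) ([x-ᵥz]-ᵥ[y-ᵥz]≡x-ᵥy y a' a) (-∈ (in-coset By) (in-coset Ba')))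
      (coset⊆block Ba')
      where
      open IsAdditiveSubgroup (Stab-isAdditiveSubgroup i)
      in-coset : ∀ {z} → B i z ≡ true → Stab i (z -ᵥ a) ≡ true
      in-coset {z} Bz = trans (sym (B≡ z)) Bz

    MapsBlock⇒Stab : ∀ {i c} → MapsBlock B (translation c) i i → Stab i c ≡ true
    MapsBlock⇒Stab {i} {c} c[i]=i = Stab⁺ (distinct _ _ λ y → trans (∈-translate c i y)
      (trans (sym (c[i]=i (y -ᵥ c))) (cong (B i) (trans (⟦translation⟧ c (y -ᵥ c)) (-ᵥ+ᵥ y c)))))

    Stab⇒MapsBlock : ∀ {i c} → Stab i c ≡ true → MapsBlock B (translation c) i i
    Stab⇒MapsBlock {i} {c} S x = trans (cong (B i) (⟦translation⟧ c x)) (Stab-invariant S x)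

    Stab-transport : ∀ {i j A e c} → Invertible A → MapsBlock B (A , e) i j → # B i ≡ # B j →
                     Stab i c ≡ true → Stab j (applyM A c) ≡ true
    Stab-transport {i} {j} {A} {e} {c} A-invertible g[i]=j #Bi≡#Bj Sc = +-closed⇒Stab closed
      where
      -- g (x + c) = g x + A c, and the injection g maps B i onto B j since both have the same size.
      g-injective : ∀ {x y} → ⟦ A , e ⟧ x ≡ ⟦ A , e ⟧ y → x ≡ y
      g-injective eq = invertible⇒injective A-invertible (+ᵥ-cancelʳ e eq)
      g-+ : ∀ x → ⟦ A , e ⟧ (x +ᵥ c) ≡ ⟦ A , e ⟧ x +ᵥ applyM A c
      g-+ x = trans (cong (_+ᵥ e) (applyM-+ A x c)) ([x+ᵥy]+ᵥz≡[x+ᵥz]+ᵥy (applyM A x) (applyM A c) e)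
      closed : ∀ {z} → B j z ≡ true → B j (z +ᵥ applyM A c) ≡ true
      closed Bz with injection-onto Vᴱ Vᴱ g-injective (λ {x} → trans (g[i]=j x)) (≤-reflexive (sym #Bi≡#Bj)) Bz
      ... | x , Bx , refl =
        trans (cong (B j) (sym (g-+ x))) (trans (g[i]=j (x +ᵥ c)) (trans (Stab-invariant Sc x) Bx))

    nontrivial-Stab-everywhere : ∀ {G k} → IsSubgroupAGL G → FlagTransitive B G → BlockSize B k → 0 < k →
                                 ∀ {i c} → Stab i c ≡ true → c ≢ 0ᵥ →
                                 ∀ j → ∃ λ c' → c' ≢ 0ᵥ × Stab j c' ≡ true
    nontrivial-Stab-everywhere (_ , _ , invertible) flag-transitive size 0<k {i} {c} Sc c≢0 j
      with count-witness Vᴱ (subst (0 <_) (sym (size i)) 0<k)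
         | count-witness Vᴱ (subst (0 <_) (sym (size j)) 0<k)
    ... | x , Bx | y , By with flag-transitive x i y j Bx By
    ... | (A , e) , g∈G , _ , g[i]=j =
      applyM A c , (λ Ac≡0 → c≢0 (invertible⇒injective A-invertible (trans Ac≡0 (sym (applyM-0 A))))) ,
      Stab-transport A-invertible g[i]=j (trans (size i) (sym (size j))) Sc
      where
      A-invertible : Invertible A
      A-invertible = invertible A e g∈G

    data OrbitShape (i : Fin b) : Set where
      coset      : ∀ a → Coset i a → OrbitShape i
      two-cosets : ∀ a a' → Stab i (a' -ᵥ a) ≡ false → TwoCosets i a a' → OrbitShape i

    coset-size : ∀ {i} a → Coset i a → # B i ≡ # Stab i
    coset-size {i} a B≡ = trans (count-cong Vᴱ B≡) (#-translate (Stab i) a)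

    two-cosets-size : ∀ {i} a a' → Stab i (a' -ᵥ a) ≡ false → TwoCosets i a a' →
                      # B i ≡ 2 * # Stab i
    two-cosets-size {i} a a' a'∉a+S B≡ = begin
      # B i                                                  ≡⟨ count-cong Vᴱ B≡ ⟩
      # (λ y → Stab i (y -ᵥ a) ∨ Stab i (y -ᵥ a'))           ≡⟨ count-∨ Vᴱ disjoint ⟩
      # (λ y → Stab i (y -ᵥ a)) + # (λ y → Stab i (y -ᵥ a')) ≡⟨ cong₂ _+_ (#-translate _ a) (#-translate _ a') ⟩
      # Stab i + # Stab i                                    ≡⟨ cong (# Stab i +_) (sym (+-identityʳ _)) ⟩
      2 * # Stab i                                           ∎
      where
      open ≡-Reasoning
      open IsAdditiveSubgroup (Stab-isAdditiveSubgroup i)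
      disjoint : ∀ y → Stab i (y -ᵥ a) ≡ true → Stab i (y -ᵥ a') ≡ true → ⊥
      disjoint y Sa Sa' = not-¬ (subst-true (Stab i) ([z-ᵥx]-ᵥ[z-ᵥy]≡y-ᵥx a a' y) (-∈ Sa Sa')) a'∉a+S

    semiregular⇒p^d∣b : TSemiregularOnBlocks B → p ^ d ∣ b
    semiregular⇒p^d∣b semiregular =
      subst₂ _∣_ (trans (count-all Vᴱ) length-allV) (trans (count-all (Finᴱ b)) (length-tabulate {n = b} id))
             (#Q∣count (λ _ _ → refl))
      where
      free : ∀ {a a' i} → translate a i ≡ translate a' i → a ≡ a'
      free eq = sym (x-ᵥy≡0⇒x≡y (semiregular _ _ (Stab⇒MapsBlock (Stab⁺ (sym (act-solve eq))))))
      everything : IsAdditiveSubgroup (λ _ → true)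
      everything = record { 0∈ = refl ; +∈ = λ _ _ → refl ; -∈ = λ _ _ → refl }
      open Orbits (Finᴱ b) free everything

    semiregular⇒k∣r : ∀ {k r} → TSemiregularOnBlocks B → BlockSize B k → Replication B r → k ∣ r
    semiregular⇒k∣r {k} {r} semiregular size replication with semiregular⇒p^d∣b semiregular
    ... | divides m b≡m*p^d = divides m (*-cancelˡ-≡ r (m * k) (p ^ d) {{m^n≢0 p d}} (begin
      p ^ d * r             ≡⟨ cong (_* r) (sym length-allV) ⟩
      length allV * r       ≡⟨ sym (double-counting B {xs = allFin b} {ys = allV} size replication) ⟩
      length (allFin b) * k ≡⟨ cong (_* k) (trans (length-tabulate {n = b} id) b≡m*p^d) ⟩
      m * p ^ d * k         ≡⟨ cong (_* k) (*-comm m (p ^ d)) ⟩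
      p ^ d * m * k         ≡⟨ *-assoc (p ^ d) m k ⟩
      p ^ d * (m * k)       ∎))
      where open ≡-Reasoning

    semiregular-or-nontrivial-Stab : TSemiregularOnBlocks B ⊎ ∃ λ i → ∃ λ c → c ≢ 0ᵥ × Stab i c ≡ true
    semiregular-or-nontrivial-Stab
      with ∃? (Finᴱ b) (λ i → ∃? Vᴱ (λ c → ¬? (c ≟ᵥ 0ᵥ) ×-dec (Stab i c Bool.≟ true)))
    ... | yes nontrivial = inj₂ nontrivial
    ... | no  ∄nontrivial = inj₁ λ c i c[i]=i →
      decidable-stable (c ≟ᵥ 0ᵥ) λ c≢0 → ∄nontrivial (i , c , c≢0 , MapsBlock⇒Stab c[i]=i)

    module _ (balanced : Balanced B 2) {i a c} (Ba : B i a ≡ true) (Sc : Stab i c ≡ true) (c≢0 : c ≢ 0ᵥ) where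

      private
        Through : Fin b → Bool
        Through j = B j a ∧ B j (a +ᵥ c)

        translate-through : ∀ {y} → B i y ≡ true → Through (translate (a -ᵥ y) i) ≡ true
        translate-through {y} By = cong₂ _∧_
          (trans (∈-translate (a -ᵥ y) i a) (trans (cong (B i) (x-ᵥ[x-ᵥy]≡y a y)) By))
          (trans (∈-translate (a -ᵥ y) i (a +ᵥ c))
                 (trans (cong (B i) ([x+ᵥz]-ᵥ[x-ᵥy]≡y+ᵥz a y c)) (trans (Stab-invariant Sc y) By)))

        translate-moves : ∀ {y} → Stab i (y -ᵥ a) ≡ false → i ≢ translate (a -ᵥ y) i
        translate-moves y∉a+S i≡ = not-¬ (Stab-sym (Stab⁺ (sym i≡))) y∉a+S

        -- B i, B i + (a - a') and B i + (a - y) all contain a and a + c, and only two blocks do.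
        in-second-coset : ∀ {a' y} → B i a' ≡ true → Stab i (a' -ᵥ a) ≡ false →
                          B i y ≡ true → Stab i (y -ᵥ a) ≡ false → Stab i (y -ᵥ a') ≡ true
        in-second-coset {a'} {y} Ba' a'∉a+S By y∉a+S =
          Stab-sym (subst-true (Stab i) ([z-ᵥx]-ᵥ[z-ᵥy]≡y-ᵥx y a' a) (Stab⁺ (sym (act-solve same-translate))))
          where
          same-translate : translate (a -ᵥ a') i ≡ translate (a -ᵥ y) i
          same-translate = other-blocks-through-pair-coincide B balanced (x≢x+ᵥc c≢0)
            (cong₂ _∧_ Ba (trans (Stab-invariant Sc a) Ba)) (translate-through Ba') (translate-through By)
            (translate-moves a'∉a+S) (translate-moves y∉a+S)

      orbit-shape : OrbitShape i
      orbit-shape with ∃? Vᴱ (λ y → (B i y Bool.≟ true) ×-dec (Stab i (y -ᵥ a) Bool.≟ false))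
      ... | no ∄y = coset a λ y → Bool-ext (in-coset y) (coset⊆block Ba)
        where
        in-coset : ∀ y → B i y ≡ true → Stab i (y -ᵥ a) ≡ true
        in-coset y By with Stab i (y -ᵥ a) in y∈a+S
        ... | true  = refl
        ... | false = contradiction (y , By , y∈a+S) ∄y
      ... | yes (a' , Ba' , a'∉a+S) = two-cosets a a' a'∉a+S λ y → Bool-ext (in-cosets y) (in-block y)
        where
        in-cosets : ∀ y → B i y ≡ true → (Stab i (y -ᵥ a) ∨ Stab i (y -ᵥ a')) ≡ true
        in-cosets y By with Stab i (y -ᵥ a) in y∈a+S
        ... | true  = refl
        ... | false = in-second-coset Ba' a'∉a+S By y∈a+S
        in-block : ∀ y → (Stab i (y -ᵥ a) ∨ Stab i (y -ᵥ a')) ≡ true → B i y ≡ true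
        in-block y S∨ = [ coset⊆block Ba , coset⊆block Ba' ] (∨-true⁻ S∨)

-- Prime p: orders of stabilisers and the non-semiregular case

module _ {p : ℕ} (p-prime : Prime p) (d : ℕ) where
  open Affine p {{prime⇒nonZero p-prime}} d
  open AffineAlgebra p {{prime⇒nonZero p-prime}} d

  #subgroup≡p^ : ∀ {Q} → IsAdditiveSubgroup Q → ∃ λ t → # Q ≡ p ^ t
  #subgroup≡p^ {Q} Q-subgroup =
    ∣p^⇒≡p^ p-prime d
      (subst (# Q ∣_) (trans (count-all Vᴱ) length-allV) (lagrange Q-subgroup (λ _ _ → refl)))

  2≤# : ∀ {Q c} → Q 0ᵥ ≡ true → Q c ≡ true → c ≢ 0ᵥ → 2 ≤ # Q
  2≤# Q0 Qc c≢0 = length≤count Vᴱ (((λ 0≡c → c≢0 (sym 0≡c)) ∷ []) ∷ [] ∷ [])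
    λ { (here refl) → Q0 ; (there (here refl)) → Qc }

  nontrivial⊆order-p⇒⊇ : ∀ {H Q c} → IsAdditiveSubgroup H → IsAdditiveSubgroup Q →
                         (∀ {x} → H x ≡ true → Q x ≡ true) → # Q ≡ p → H c ≡ true → c ≢ 0ᵥ →
                         ∀ {x} → Q x ≡ true → H x ≡ true
  nontrivial⊆order-p⇒⊇ {H} {Q} H-subgroup Q-subgroup H⊆Q #Q≡p Hc c≢0 Qx =
    let _ , Hx′ , x′≡x = injection-onto Vᴱ Vᴱ id H⊆Q (≤-reflexive (trans #Q≡p (sym #H≡p))) Qx
    in subst-true H x′≡x Hx′
    where
    #H∣p : # H ∣ p
    #H∣p = subst (# H ∣_) #Q≡p (lagrange H-subgroup (λ Ha Qx → IsAdditiveSubgroup.+∈ Q-subgroup Qx (H⊆Q Ha)))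
    #H≡p : # H ≡ p
    #H≡p with prime⇒irreducible p-prime #H∣p
    ... | inj₁ #H≡1 = contradiction (2≤# (IsAdditiveSubgroup.0∈ H-subgroup) Hc c≢0) (<-irrefl (sym #H≡1))
    ... | inj₂ #H≡p = #H≡p

  order-p-subgroups-sharing-nonzero-coincide : ∀ {Q Q' c} → IsAdditiveSubgroup Q → IsAdditiveSubgroup Q' →
    # Q ≡ p → # Q' ≡ p → Q c ≡ true → Q' c ≡ true → c ≢ 0ᵥ → ∀ x → Q x ≡ Q' x
  order-p-subgroups-sharing-nonzero-coincide Q-subgroup Q'-subgroup #Q≡p #Q'≡p Qc Q'c c≢0 x =
    Bool-ext (λ Qx → ∧-conicalʳ _ _ (Q⊆Q∩Q' Qx)) (λ Q'x → ∧-conicalˡ _ _ (Q'⊆Q∩Q' Q'x))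
    where
    Q∩Q'-subgroup = ∩-isAdditiveSubgroup Q-subgroup Q'-subgroup
    c∈Q∩Q' = cong₂ _∧_ Qc Q'c
    Q⊆Q∩Q'  = nontrivial⊆order-p⇒⊇ Q∩Q'-subgroup Q-subgroup  (∧-conicalˡ _ _) #Q≡p  c∈Q∩Q' c≢0
    Q'⊆Q∩Q' = nontrivial⊆order-p⇒⊇ Q∩Q'-subgroup Q'-subgroup (∧-conicalʳ _ _) #Q'≡p c∈Q∩Q' c≢0

  2∣p⇒p≡2 : 2 ∣ p → p ≡ 2
  2∣p⇒p≡2 2∣p with prime⇒irreducible p-prime 2∣p
  ... | inj₁ ()
  ... | inj₂ 2≡p = sym 2≡p

  module _ {b k} {B : Fin b → V → Bool} (distinct : DistinctBlocks B)
           (translates : ∀ c i → ∃ λ j → MapsBlock B (translation c) i j)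
           (balanced : Balanced B 2) (size : BlockSize B k) where
    open TranslatedBlocks B distinct translates

    AffineBlocksOfPrimePowerSize TwiceOddPrimePowerSize : Set
    AffineBlocksOfPrimePowerSize = Σ ℕ (λ t → 1 < t × k ≡ p ^ t × BlocksAreAffineSubspaces B)
    TwiceOddPrimePowerSize       = Σ ℕ (λ t → 1 ≤ t × ¬ (2 ∣ p) × k ≡ 2 * p ^ t)

    two-cosets⇒2∣k : ∀ {i a a'} → Stab i (a' -ᵥ a) ≡ false → TwoCosets i a a' → 2 ∣ k
    two-cosets⇒2∣k {i} {a} {a'} a'∉a+S B≡ =
      divides (# Stab i) (trans (sym (size i)) (trans (two-cosets-size a a' a'∉a+S B≡) (*-comm 2 (# Stab i))))

    k-odd⇒coset : ¬ 2 ∣ k → ∀ {i} → OrbitShape i → ∃ (Coset i)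
    k-odd⇒coset _     (coset a B≡)                 = a , B≡
    k-odd⇒coset k-odd (two-cosets _ _ a'∉a+S B≡) = contradiction (two-cosets⇒2∣k a'∉a+S B≡) k-odd

    orbit-shapes : ∀ {G} → IsSubgroupAGL G → FlagTransitive B G → 0 < k →
                   ∀ {i c} → Stab i c ≡ true → c ≢ 0ᵥ → ∀ j → OrbitShape j
    orbit-shapes subgroup flag-transitive 0<k Sc c≢0 j
      with nontrivial-Stab-everywhere subgroup flag-transitive size 0<k Sc c≢0 j
         | count-witness Vᴱ (subst (0 <_) (sym (size j)) 0<k)
    ... | c' , c'≢0 , Sc' | y , By = orbit-shape balanced By Sc' c'≢0

    k≢p : 2 < k → (∀ j → OrbitShape j) → ∀ {i c} → Stab i c ≡ true → c ≢ 0ᵥ → k ≢ p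
    k≢p 2<k shapes {i} {c} Sc c≢0 k≡p = i₁≢i (distinct i₁ i λ y → begin
      B i₁ y             ≡⟨ B₁≡ y ⟩
      Stab i₁ (y -ᵥ a)   ≡⟨ sym (Stab-i≡Stab-i₁ (y -ᵥ a)) ⟩
      Stab i (y -ᵥ a)    ≡⟨ sym (B≡ y) ⟩
      B i y              ∎)
      where
      open ≡-Reasoning
      k-odd : ¬ 2 ∣ k
      k-odd 2∣k = >⇒≢ 2<k (trans k≡p (2∣p⇒p≡2 (subst (2 ∣_) k≡p 2∣k)))
      #Stab≡p : ∀ {j a} → Coset j a → # Stab j ≡ p
      #Stab≡p {j} {a} B≡ = trans (sym (coset-size a B≡)) (trans (size j) k≡p)
      a  = proj₁ (k-odd⇒coset k-odd (shapes i))
      B≡ = proj₂ (k-odd⇒coset k-odd (shapes i))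
      a∈ : B i a ≡ true
      a∈ = trans (B≡ a) (trans (cong (Stab i) (x-ᵥx≡0 a)) (IsAdditiveSubgroup.0∈ (Stab-isAdditiveSubgroup i)))
      other = another-block-through-pair B balanced (x≢x+ᵥc c≢0) (cong₂ _∧_ a∈ (trans (Stab-invariant Sc a) a∈))
      i₁       = proj₁ other
      i₁≢i     = proj₁ (proj₂ other)
      i₁∋a,a+c = proj₂ (proj₂ other)
      B₁≡′ = proj₂ (k-odd⇒coset k-odd (shapes i₁))
      B₁≡ : Coset i₁ a
      B₁≡ = coset-recentre B₁≡′ (∧-conicalˡ _ _ i₁∋a,a+c)
      c∈Stab-i₁ : Stab i₁ c ≡ true
      c∈Stab-i₁ = subst-true (Stab i₁) ([x+ᵥy]-ᵥx≡y a c) (trans (sym (B₁≡ (a +ᵥ c))) (∧-conicalʳ _ _ i₁∋a,a+c))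
      Stab-i≡Stab-i₁ : ∀ x → Stab i x ≡ Stab i₁ x
      Stab-i≡Stab-i₁ = order-p-subgroups-sharing-nonzero-coincide (Stab-isAdditiveSubgroup i) (Stab-isAdditiveSubgroup i₁)
                         (#Stab≡p B≡) (#Stab≡p B₁≡′) Sc c∈Stab-i₁ c≢0

    blocks-affine : p ≡ 2 ⊎ ¬ 2 ∣ k → (∀ j → OrbitShape j) → BlocksAreAffineSubspaces B
    blocks-affine char-2-or-k-odd shapes j with shapes j | char-2-or-k-odd
    ... | coset a B≡ | _ = a , Stab j , subgroup⇒subspace (Stab-isAdditiveSubgroup j) , B≡
    ... | two-cosets a a' a'∉a+S B≡ | inj₂ k-odd = contradiction (two-cosets⇒2∣k a'∉a+S B≡) k-odd
    ... | two-cosets a a' a'∉a+S B≡ | inj₁ p≡2   =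
      a , (λ z → Stab j z ∨ Stab j (z -ᵥ (a' -ᵥ a))) ,
      subgroup-∪-coset-isSubspace p≡2 (Stab-isAdditiveSubgroup j) (a' -ᵥ a) ,
      λ x → trans (B≡ x) (cong (λ z → Stab j (x -ᵥ a) ∨ Stab j z) (sym ([x-ᵥz]-ᵥ[y-ᵥz]≡x-ᵥy x a' a)))

    coset-case : 2 < k → (∀ j → OrbitShape j) → ∀ {i c a} → Stab i c ≡ true → c ≢ 0ᵥ →
                 Coset i a → AffineBlocksOfPrimePowerSize
    coset-case 2<k shapes {i} {c} {a} Sc c≢0 B≡ with #subgroup≡p^ (Stab-isAdditiveSubgroup i)
    ... | t , #S≡p^t = t , 1<t t k≡p^t , k≡p^t , blocks-affine char-2-or-k-odd shapes
      where
      k≡p^t : k ≡ p ^ t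
      k≡p^t = trans (sym (size i)) (trans (coset-size a B≡) #S≡p^t)
      1<t : ∀ t → k ≡ p ^ t → 1 < t
      1<t 0             k≡1 = contradiction k≡1 (>⇒≢ (<-trans (s<s z<s) 2<k))
      1<t 1             k≡p = contradiction (trans k≡p (*-identityʳ p)) (k≢p 2<k shapes Sc c≢0)
      1<t (suc (suc _)) _   = s<s z<s
      char-2-or-k-odd : p ≡ 2 ⊎ ¬ 2 ∣ k
      char-2-or-k-odd with 2 ∣? p
      ... | yes 2∣p = inj₁ (2∣p⇒p≡2 2∣p)
      ... | no  2∤p = inj₂ λ 2∣k → 2∤p (∣m^⇒∣m prime[2] t (subst (2 ∣_) k≡p^t 2∣k))

    two-cosets-case : 2 < k → (∀ j → OrbitShape j) → ∀ {i a a'} → Stab i (a' -ᵥ a) ≡ false →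
                      TwoCosets i a a' →
                      AffineBlocksOfPrimePowerSize ⊎ TwiceOddPrimePowerSize
    two-cosets-case 2<k shapes {i} {a} {a'} a'∉a+S B≡ with #subgroup≡p^ (Stab-isAdditiveSubgroup i)
    ... | t , #S≡p^t = by-parity (2 ∣? p)
      where
      k≡2*p^t : k ≡ 2 * p ^ t
      k≡2*p^t = trans (sym (size i)) (trans (two-cosets-size a a' a'∉a+S B≡) (cong (2 *_) #S≡p^t))
      positive : ∀ t → k ≡ 2 * p ^ t → 1 ≤ t
      positive 0       k≡2 = contradiction k≡2 (>⇒≢ 2<k)
      positive (suc _) _   = s≤s z≤n
      1≤t : 1 ≤ t
      1≤t = positive t k≡2*p^t
      by-parity : Dec (2 ∣ p) → AffineBlocksOfPrimePowerSize ⊎ TwiceOddPrimePowerSize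
      by-parity (yes 2∣p) =
        inj₁ (suc t , s≤s 1≤t , trans k≡2*p^t (cong (_* p ^ t) (sym p≡2)) , blocks-affine (inj₁ p≡2) shapes)
        where p≡2 = 2∣p⇒p≡2 2∣p
      by-parity (no 2∤p)  = inj₂ (t , 1≤t , 2∤p , k≡2*p^t)

    non-semiregular-case : ∀ {G} → 2 < k → IsSubgroupAGL G → FlagTransitive B G →
                           ∀ {i c} → Stab i c ≡ true → c ≢ 0ᵥ →
                           AffineBlocksOfPrimePowerSize ⊎ TwiceOddPrimePowerSize
    non-semiregular-case 2<k subgroup flag-transitive {i} Sc c≢0 = by-shape (shapes i)
      where
      shapes = orbit-shapes subgroup flag-transitive (<-trans z<s 2<k) Sc c≢0
      by-shape : OrbitShape i → AffineBlocksOfPrimePowerSize ⊎ TwiceOddPrimePowerSize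
      by-shape (coset a B≡)                 = inj₁ (coset-case 2<k shapes Sc c≢0 B≡)
      by-shape (two-cosets a a' a'∉a+S B≡) = two-cosets-case 2<k shapes a'∉a+S B≡

corollary2p6 : (p d : ℕ) (pr : Prime p) →
    let open Affine p {{prime⇒nonZero pr}} d in
    (k r b : ℕ) (B : Fin b → V → Bool) (G : Aff → Set) →
    -- D = (V, {B i}) is a 2-(p^d, k, 2) design with replication number r
    DistinctBlocks B → BlockSize B k → Balanced B 2 → Replication B r →
    2 < k → k < p ^ d →
    -- G ≤ AGL_d(p), T ≤ G, G₀ irreducible, G ≤ Aut(D), G flag-transitive
    IsSubgroupAGL G → ContainsTranslations G → G₀Irreducible G →
    Automorphisms B G → FlagTransitive B G →
    -- r is even
    2 ∣ r →
    (TSemiregularOnBlocks B × k ∣ r)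
    ⊎ (¬ TSemiregularOnBlocks B
       × ((Σ ℕ (λ t → 1 < t × k ≡ p ^ t × BlocksAreAffineSubspaces B))
          ⊎ (Σ ℕ (λ t → 1 ≤ t × ¬ (2 ∣ p) × k ≡ 2 * p ^ t))))
corollary2p6 p d pr k r b B G distinct size balanced replication 2<k _ subgroup translations _
             automorphisms flag-transitive _ =
  [ (λ semiregular → inj₁ (semiregular , semiregular⇒k∣r semiregular size replication))
  , (λ (i , c , c≢0 , Sc) →
       inj₂ ( (λ semiregular → c≢0 (semiregular c i (Stab⇒MapsBlock Sc)))
            , non-semiregular-case pr d distinct translates balanced size 2<k subgroup flag-transitive Sc c≢0))
  ] semiregular-or-nontrivial-Stab
  where
  open Affine p {{prime⇒nonZero pr}} d
  open AffineAlgebra p {{prime⇒nonZero pr}} d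
  translates : ∀ c i → ∃ λ j → MapsBlock B (translation c) i j
  translates c = automorphisms (translation c) (translations c)
  open TranslatedBlocks B distinct translates
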